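{- Let $(\mathcal{M}^{\dagger},\textsf{AX}^{\dagger})$ be any one of the four pairs $(\mathcal{M},\textsf{AX})$, $(\mathcal{M}_{\mathrm{det}},\textsf{AX}_{\mathrm{det}})$, $(\mathcal{M}^{\downarrow},\textsf{AX}^{\downarrow})$, $(\mathcal{M}^{\downarrow}_{\mathrm{det}},\textsf{AX}^{\downarrow}_{\mathrm{det}})$. Then $\textsf{AX}^{\dagger}$ is sound and complete for validities with respect to $\mathcal{M}^{\dagger}$: for every $\varphi \in \mathcal{L}$, $\varphi$ is provable in $\textsf{AX}^{\dagger}$ if and only if $\mathfrak{M}\models\varphi$ for every model $\mathfrak{M}\in\mathcal{M}^{\dagger}$.
   Context: Language. Fix propositional atoms $X_1,X_2,X_3,\dots$. $\mathcal{L}_{\mathrm{prop}}$ is the set of propositional formulas over these atoms (closed under $\land,\lor,\lnot$). $\mathcal{L}_{\mathrm{int}}\subset\mathcal{L}_{\mathrm{prop}}$ consists of $\top$ together with all formulas $l_{i_1}\land\dots\land l_{i_n}$ with $i_1<i_2<\dots<i_n$ and each $l_{i_j}$ equal to $X_{i_j}$ or $\lnot X_{i_j}$. $\mathcal{L}_{\mathrm{cond}}$ is the set of formulas $[\alpha]\beta$ with $\alpha\in\mathcal{L}_{\mathrm{int}}$, $\beta\in\mathcal{L}_{\mathrm{prop}}$. $\mathcal{L}$ is the set of propositional formulas (closed under $\land,\lor,\lnot$) over the atoms $\{X_i\}\cup\mathcal{L}_{\mathrm{cond}}$. $\alpha\to\beta$ abbreviates $\lnot\alpha\lor\beta$, $\leftrightarrow$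 is defined as usual, and $\langle\alpha\rangle\beta$ abbreviates $\lnot[\alpha]\lnot\beta$. Semantics. A causal simulation model is a pair $(\mathsf{T},\mathbf{x})$ where $\mathsf{T}$ is a (possibly non-deterministic) Turing machine whose tape consists of binary variables $X_1,X_2,\dots$, and $\mathbf{x}=\{x_n\}_{n\in\mathbb{N}}$ is a state description assigning a value in $\{0,1\}$ to each tape variable, with only finitely many nonzero. A halting run of $\mathsf{T}$ on $\mathbf{x}$ yields an output state description. For $\alpha\in\mathcal{L}_{\mathrm{int}}$, the intervention $\mathcal{I}_\alpha$ maps $\mathsf{T}$ to the machine $\mathcal{I}_\alpha(\mathsf{T})$ that first sets each variable $X_i$ occurring in $\alpha$ to $1$ if $X_i$ is a literal of $\alpha$ and to $0$ if $\lnot X_i$ is, and then runs $\mathsf{T}$ while ignoring every write to those variables (so they stay fixed throughout). Satisfaction: $(\mathsf{T},\mathbf{x})\models X_i$ iff $x_i=1$; $(\mathsf{T},\mathbf{x})\models[\alpha]\beta$ iff every halting execution of $\mathcal{I}_\alpha(\mathsf{T})$ on $\mathbf{x}$ yields a tape satisfying $\beta$ (propositionally, with $X_i$ true iff its value is $1$); Boolean connectives are interpreted as usual. Thus $(\mathsf{T},\mathbf{x})\models\langle\alpha\rangle\beta$ iff some halting execution of $\mathcal{I}_\alpha(\mathsf{T})$ on $\mathbf{x}$ yields a tape satisfying $\beta$. Model classes. $\mathcal{M}$: all causal simulation models; $\mathcal{M}_{\mathrm{det}}$: those with deterministic $\mathsf{T}$; $\mathcal{M}^{\downarrow}$: those with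 (possibly non-deterministic) $\mathsf{T}$ that halt on all input tapes under all interventions; $\mathcal{M}^{\downarrow}_{\mathrm{det}}=\mathcal{M}_{\mathrm{det}}\cap\mathcal{M}^{\downarrow}$. Axiom systems (all formulas below range over $\alpha\in\mathcal{L}_{\mathrm{int}}$, $\beta,\beta',\gamma\in\mathcal{L}_{\mathrm{prop}}$): PC: propositional calculus over the atoms of $\mathcal{L}$; RW: from $\beta\to\beta'$ infer $[\alpha]\beta\to[\alpha]\beta'$; R: $[\alpha]\alpha$; K: $[\alpha](\beta\to\gamma)\to([\alpha]\beta\to[\alpha]\gamma)$; F: $\langle\alpha\rangle\beta\to[\alpha]\beta$; D: $[\alpha]\beta\to\langle\alpha\rangle\beta$. $\textsf{AX}$ contains axioms R and K and is closed under PC and RW; $\textsf{AX}_{\mathrm{det}}=\textsf{AX}+\textsf{F}$; $\textsf{AX}^{\downarrow}=\textsf{AX}+\textsf{D}$; $\textsf{AX}^{\downarrow}_{\mathrm{det}}=\textsf{AX}+\textsf{F}+\textsf{D}$. -}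

module Defs where

open import Data.Nat using (ℕ; zero; suc; _<_; _≤_; _≡ᵇ_)
open import Data.Bool using (Bool; true; false; if_then_else_; _∧_; _∨_; not)
open import Data.Fin using (Fin)
open import Data.List using (List; []; _∷_; length)
open import Data.List.Relation.Unary.Linked using (Linked)
open import Data.List.Membership.Propositional using (_∈_)
open import Data.Maybe using (Maybe; just; nothing)
open import Data.Product using (Σ; _×_; _,_; proj₁; proj₂; ∃)
open import Data.Unit using (⊤)
open import Data.Empty using (⊥)
open import Relation.Nullary using (¬_)
open import Relation.Binary.PropositionalEquality using (_≡_)

-- Syntax
-- Atoms X_1, X_2, ... are indexed by ℕ (atom `var i` stands for X_{i+1}).

-- L_prop (⊤ included, since L_int ⊆ L_prop and ⊤ ∈ L_int)
data PForm : Set where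
  pvar : ℕ → PForm
  p⊤   : PForm
  p¬   : PForm → PForm
  _p∧_ : PForm → PForm → PForm
  _p∨_ : PForm → PForm → PForm

_p⇒_ : PForm → PForm → PForm
a p⇒ b = p¬ a p∨ b

Lit : Set
Lit = ℕ × Bool

-- L_int: conjunctions of literals with strictly increasing indices
-- (the empty list is ⊤)
Lint : Set
Lint = Σ (List Lit) (Linked (λ a b → proj₁ a < proj₁ b))

litP : Lit → PForm
litP (i , true)  = pvar i
litP (i , false) = p¬ (pvar i)

conjP : List Lit → PForm
conjP []           = p⊤
conjP (l ∷ [])     = litP l
conjP (l ∷ m ∷ ls) = litP l p∧ conjP (m ∷ ls)

intP : Lint → PForm
intP α = conjP (proj₁ α)

data Form : Set where
  var  : ℕ → Form
  box  : Lint → PForm → Form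
  f⊤   : Form
  f¬   : Form → Form
  _f∧_ : Form → Form → Form
  _f∨_ : Form → Form → Form

_⇒_ : Form → Form → Form
a ⇒ b = f¬ a f∨ b

dia : Lint → PForm → Form
dia α β = f¬ (box α (p¬ β))

ι : PForm → Form
ι (pvar i)  = var i
ι p⊤        = f⊤
ι (p¬ a)    = f¬ (ι a)
ι (a p∧ b)  = ι a f∧ ι b
ι (a p∨ b)  = ι a f∨ ι b

record Valuation : Set where
  field
    vX   : ℕ → Bool
    vBox : Lint → PForm → Bool

evalP : (ℕ → Bool) → PForm → Bool
evalP v (pvar i) = v i
evalP v p⊤       = true
evalP v (p¬ a)   = not (evalP v a)
evalP v (a p∧ b) = evalP v a ∧ evalP v b
evalP v (a p∨ b) = evalP v a ∨ evalP v b

evalF : Valuation → Form → Bool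
evalF V (var i)   = Valuation.vX V i
evalF V (box α β) = Valuation.vBox V α β
evalF V f⊤        = true
evalF V (f¬ a)    = not (evalF V a)
evalF V (a f∧ b)  = evalF V a ∧ evalF V b
evalF V (a f∨ b)  = evalF V a ∨ evalF V b

Tautology : Form → Set
Tautology φ = (V : Valuation) → evalF V φ ≡ true

-- AX = (false,false), AX_det = (true,false), AX↓ = (false,true),
-- AX↓_det = (true,true).

record AxSys : Set where
  constructor axsys
  field
    withF : Bool
    withD : Bool

data _⊢_ (S : AxSys) : Form → Set where
  pc-taut : ∀ {φ} → Tautology φ → S ⊢ φ
  pc-mp   : ∀ {φ ψ} → S ⊢ φ → S ⊢ (φ ⇒ ψ) → S ⊢ ψ
  rule-RW : ∀ {α β β'} → S ⊢ ι (β p⇒ β') → S ⊢ (box α β ⇒ box α β')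
  ax-R : ∀ {α} → S ⊢ box α (intP α)
  ax-K : ∀ {α β γ} → S ⊢ (box α (β p⇒ γ) ⇒ (box α β ⇒ box α γ))
  ax-F : ∀ {α β} → AxSys.withF S ≡ true → S ⊢ (dia α β ⇒ box α β)
  ax-D : ∀ {α β} → AxSys.withD S ≡ true → S ⊢ (box α β ⇒ dia α β)

-- The head starts on X_1 (position 0); a left move at position 0 stays.
-- A machine halts when no transition applies to the current
-- (state, scanned symbol).

data Move : Set where
  left right : Move

record TM : Set where
  field
    nStates : ℕ
    start   : Fin nStates
    δ       : Fin nStates → Bool → List (Fin nStates × Bool × Move)

Tape : Set
Tape = ℕ → Bool

StateDesc : Set
StateDesc = Σ Tape (λ t → ∃ λ N → ∀ n → N ≤ n → t n ≡ false)

record Config (T : TM) : Set where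
  constructor cfg
  field
    state : Fin (TM.nStates T)
    pos   : ℕ
    tape  : Tape

move : Move → ℕ → ℕ
move left  zero    = zero
move left  (suc n) = n
move right n       = suc n

fixedBy : List Lit → ℕ → Maybe Bool
fixedBy []             n = nothing
fixedBy ((i , b) ∷ ls) n = if i ≡ᵇ n then just b else fixedBy ls n

-- initial tape of I_α(T) on x: the variables in α set to their values
setTape : Lint → Tape → Tape
setTape α x n with fixedBy (proj₁ α) n
... | just b  = b
... | nothing = x n

writeI : Lint → ℕ → Bool → Tape → Tape
writeI α p b t with fixedBy (proj₁ α) p
... | just _  = t
... | nothing = λ n → if n ≡ᵇ p then b else t n

read : ∀ {T} → Config T → Bool
read c = Config.tape c (Config.pos c)

options : ∀ {T} → Config T → List (Fin (TM.nStates T) × Bool × Move)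
options {T} c = TM.δ T (Config.state c) (read c)

next : ∀ {T} → Lint → (c : Config T) →
       Fin (TM.nStates T) × Bool × Move → Config T
next α c (q , b , m) =
  cfg q (move m (Config.pos c)) (writeI α (Config.pos c) b (Config.tape c))

initCfg : (T : TM) → Lint → Tape → Config T
initCfg T α x = cfg (TM.start T) zero (setTape α x)

data HRun (T : TM) (α : Lint) : Config T → Tape → Set where
  halted : ∀ {c} → options c ≡ [] → HRun T α c (Config.tape c)
  step   : ∀ {c o t} → o ∈ options c → HRun T α (next α c o) t → HRun T α c t

data AllHalt (T : TM) (α : Lint) : Config T → Set where
  go : ∀ {c} → (∀ {o} → o ∈ options c → AllHalt T α (next α c o)) →
       AllHalt T α c

record Model : Set where
  constructor model
  field
    machine : TM
    input   : StateDesc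

-- classical reading of the connectives (∨ as ¬(¬A ∧ ¬B)); all clauses
-- are ¬¬-stable
_⊨_ : Model → Form → Set
M ⊨ var i   = proj₁ (Model.input M) i ≡ true
M ⊨ box α β = ∀ t → HRun T α (initCfg T α (proj₁ (Model.input M))) t →
              evalP t β ≡ true
  where T = Model.machine M
M ⊨ f⊤      = ⊤
M ⊨ f¬ φ    = ¬ (M ⊨ φ)
M ⊨ (φ f∧ ψ) = (M ⊨ φ) × (M ⊨ ψ)
M ⊨ (φ f∨ ψ) = ¬ ((¬ (M ⊨ φ)) × (¬ (M ⊨ ψ)))

Deterministic : TM → Set
Deterministic T = ∀ q b → length (TM.δ T q b) ≤ 1

AlwaysHalts : TM → Set
AlwaysHalts T = ∀ (α : Lint) (x : StateDesc) →
                AllHalt T α (initCfg T α (proj₁ x))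

-- model classes, indexed by the same flags as the axiom systems:
-- (false,false) = M, (true,false) = M_det, (false,true) = M↓,
-- (true,true) = M↓_det
InClass : AxSys → Model → Set
InClass (axsys d h) M = (d ≡ true → Deterministic (Model.machine M))
                      × (h ≡ true → AlwaysHalts (Model.machine M))

Valid : AxSys → Form → Set
Valid S φ = (M : Model) → InClass S M → M ⊨ φ

-- Soundness is checked rule by rule: R holds because an intervention write-protects the variables it
-- sets, F because a deterministic machine has at most one halting run, D because a machine that always
-- halts has at least one, and RW because a formula of L_prop valid in all models is a tautology (the
-- machine that halts at once shows this).
--
-- Completeness: split on the truth values of all atoms of φ. On a branch Γ under which φ is not a
-- tautological consequence, either a negated box [α]β of Γ is derivable from the positive boxes at α
-- (via R, K, RW, and F resp. D when the models must be deterministic resp. halting), or Γ has a model.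
-- Its machine detects the intervention by trying to overwrite each of the first N cells (N bounds the
-- variables in Γ) and reading them back, and then writes one of the tapes that satisfy α and the
-- positive boxes at α; when deterministic, it writes a single tape falsifying all negated boxes at α.

module Submission where

open import Defs
open import Function.Base using (_∘_)
open import Function.Bundles using (_⇔_; mk⇔; Equivalence)
open import Data.Bool using (Bool; true; false; if_then_else_; _∧_; _∨_; not; T)
open import Data.Bool.Properties using (T-≡; ∨-identityʳ; ¬-not) renaming (_≟_ to _≟ᵇ_)
open import Data.Bool.ListAction using (all)
open import Data.Nat using (ℕ; zero; suc; _<_; _≤_; _≡ᵇ_; z≤n; s≤s; _⊔_; _+_)
open import Data.Nat.Properties
  using ( _≟_; _<?_; <-irrelevant; <-irrefl; <-trans; <-≤-trans; ≤-refl; ≤-trans; ≤-pred; n≤1+n; m≤n+m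
        ; ≤∧≢⇒<; ≮⇒≥; <-cmp; +-suc; +-identityʳ; m≤m⊔n; m≤n⊔m; ⊔-lub; ⊔-mono-≤ )
open import Data.Fin using (Fin)
import Data.Fin as Fin
open import Data.List
  using (List; []; _∷_; _++_; length; map; lookup; concatMap; applyUpTo; downFrom; filter; take; null)
import Data.List.Properties as List
open import Data.List.Properties using (length-map; length-applyUpTo)
open import Data.List.Relation.Unary.Any using (Any; here; there; index; any?)
import Data.List.Relation.Unary.Any as Any
open import Data.List.Relation.Unary.Any.Properties using (lookup-index)
open import Data.List.Relation.Unary.All using (All; all?)
import Data.List.Relation.Unary.All as All
open import Data.List.Relation.Unary.All.Properties using (all⁺; ¬All⇒Any¬; ¬Any⇒All¬)
open import Data.List.Relation.Unary.Linked using (Linked; []; _∷_)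
import Data.List.Relation.Unary.Linked as Linked
open import Data.List.Membership.Propositional using (_∈_; find)
open import Data.List.Membership.Propositional.Properties
  using (∈-++⁺ˡ; ∈-++⁺ʳ; ∈-map⁺; ∈-map⁻; ∈-concatMap⁺; ∈-concatMap⁻; ∈-downFrom⁺
        ; ∈-filter⁺; ∈-filter⁻)
import Data.List.Membership.DecPropositional as DecMembership
open import Data.Maybe using (Maybe; just; nothing)
import Data.Maybe.Properties as Maybe
open import Data.Maybe.Properties using (just-injective)
open import Data.Product using (Σ; _×_; _,_; proj₁; proj₂; map₂)
import Data.Product.Properties as Product
open import Data.Sum using (_⊎_; inj₁; inj₂; [_,_]′)
open import Data.Unit using (tt)
open import Data.Empty using (⊥-elim)
open import Relation.Nullary using (¬_; Dec; yes; no; does; contradiction)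
open import Relation.Nullary.Decidable using (map′; _×-dec_)
open import Relation.Binary.Definitions using (DecidableEquality; tri<; tri≈; tri>)
open import Relation.Binary.PropositionalEquality using (_≡_; _≢_; refl; sym; trans; cong; cong₂; subst)

open Equivalence using (to; from)

¬-⇔ : ∀ {P : Set} b → P ⇔ (b ≡ true) → (¬ P) ⇔ (not b ≡ true)
¬-⇔ true  P⇔b = mk⇔ (λ ¬p → ⊥-elim (¬p (from P⇔b refl))) (λ ())
¬-⇔ false P⇔b = mk⇔ (λ _ → refl) (λ _ p → contradiction (to P⇔b p) λ ())

×-⇔ : ∀ {P Q : Set} b c → P ⇔ (b ≡ true) → Q ⇔ (c ≡ true) → (P × Q) ⇔ (b ∧ c ≡ true)
×-⇔ true  c P⇔b Q⇔c = mk⇔ (to Q⇔c ∘ proj₂) (λ c≡t → from P⇔b refl , from Q⇔c c≡t)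
×-⇔ false c P⇔b Q⇔c = mk⇔ (to P⇔b ∘ proj₁) (λ ())

¬×¬-⇔ : ∀ {P Q : Set} b c → P ⇔ (b ≡ true) → Q ⇔ (c ≡ true) →
        (¬ (¬ P × ¬ Q)) ⇔ (b ∨ c ≡ true)
¬×¬-⇔ true  c     P⇔b Q⇔c = mk⇔ (λ _ → refl) (λ _ (¬p , _) → ¬p (from P⇔b refl))
¬×¬-⇔ false true  P⇔b Q⇔c = mk⇔ (λ _ → refl) (λ _ (_ , ¬q) → ¬q (from Q⇔c refl))
¬×¬-⇔ false false P⇔b Q⇔c =
  mk⇔ (λ ¬¬ → ⊥-elim (¬¬ ( (λ p → contradiction (to P⇔b p) λ ())
                          , (λ q → contradiction (to Q⇔c q) λ ()))))
      (λ ())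

true-stable : {b : Bool} → ¬ ¬ (b ≡ true) → b ≡ true
true-stable {true}  _   = refl
true-stable {false} ¬¬b = ⊥-elim (¬¬b λ ())

⊨-stable : ∀ M φ → ¬ ¬ (M ⊨ φ) → M ⊨ φ
⊨-stable M (var i)   ¬¬⊨ = true-stable ¬¬⊨
⊨-stable M (box α β) ¬¬⊨ = λ t r → true-stable (λ ¬β → ¬¬⊨ (λ ⊨box → ¬β (⊨box t r)))
⊨-stable M f⊤        ¬¬⊨ = tt
⊨-stable M (f¬ φ)    ¬¬⊨ = λ ⊨φ → ¬¬⊨ (λ ¬⊨φ → ¬⊨φ ⊨φ)
⊨-stable M (φ f∧ ψ)  ¬¬⊨ = ⊨-stable M φ (λ ¬⊨φ → ¬¬⊨ (¬⊨φ ∘ proj₁))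
                         , ⊨-stable M ψ (λ ¬⊨ψ → ¬¬⊨ (¬⊨ψ ∘ proj₂))
⊨-stable M (φ f∨ ψ)  ¬¬⊨ = λ ¬φ×¬ψ → ¬¬⊨ (λ ¬⊨ → ¬⊨ ¬φ×¬ψ)

⊨⇒-intro : ∀ M φ ψ → (M ⊨ φ → M ⊨ ψ) → M ⊨ (φ ⇒ ψ)
⊨⇒-intro M φ ψ f (¬¬φ , ¬ψ) = ¬¬φ (¬ψ ∘ f)

⊨⇒-elim : ∀ M φ ψ → M ⊨ (φ ⇒ ψ) → M ⊨ φ → M ⊨ ψ
⊨⇒-elim M φ ψ φ⇒ψ ⊨φ = ⊨-stable M ψ (λ ¬ψ → φ⇒ψ ((λ ¬φ → ¬φ ⊨φ) , ¬ψ))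

data Atom : Set where
  avar : ℕ → Atom
  abox : Lint → PForm → Atom

⌜_⌝ : Atom → Form
⌜ avar i ⌝   = var i
⌜ abox α β ⌝ = box α β

atoms : Form → List Atom
atoms (var i)   = avar i ∷ []
atoms (box α β) = abox α β ∷ []
atoms f⊤        = []
atoms (f¬ φ)    = atoms φ
atoms (φ f∧ ψ)  = atoms φ ++ atoms ψ
atoms (φ f∨ ψ)  = atoms φ ++ atoms ψ

truth-lemma : ∀ M V φ → (∀ {a} → a ∈ atoms φ → (M ⊨ ⌜ a ⌝) ⇔ (evalF V ⌜ a ⌝ ≡ true)) →
              (M ⊨ φ) ⇔ (evalF V φ ≡ true)
truth-lemma M V (var i)   atom⇔ = atom⇔ (here refl)
truth-lemma M V (box α β) atom⇔ = atom⇔ (here refl)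
truth-lemma M V f⊤        atom⇔ = mk⇔ (λ _ → refl) (λ _ → tt)
truth-lemma M V (f¬ φ)    atom⇔ = ¬-⇔ _ (truth-lemma M V φ atom⇔)
truth-lemma M V (φ f∧ ψ)  atom⇔ = ×-⇔ _ _ (truth-lemma M V φ (atom⇔ ∘ ∈-++⁺ˡ))
                                          (truth-lemma M V ψ (atom⇔ ∘ ∈-++⁺ʳ (atoms φ)))
truth-lemma M V (φ f∨ ψ)  atom⇔ = ¬×¬-⇔ _ _ (truth-lemma M V φ (atom⇔ ∘ ∈-++⁺ˡ))
                                            (truth-lemma M V ψ (atom⇔ ∘ ∈-++⁺ʳ (atoms φ)))

evalF-cong : ∀ V V′ φ → (∀ {a} → a ∈ atoms φ → evalF V ⌜ a ⌝ ≡ evalF V′ ⌜ a ⌝) →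
             evalF V φ ≡ evalF V′ φ
evalF-cong V V′ (var i)   agree = agree (here refl)
evalF-cong V V′ (box α β) agree = agree (here refl)
evalF-cong V V′ f⊤        agree = refl
evalF-cong V V′ (f¬ φ)    agree = cong not (evalF-cong V V′ φ agree)
evalF-cong V V′ (φ f∧ ψ)  agree =
  cong₂ _∧_ (evalF-cong V V′ φ (agree ∘ ∈-++⁺ˡ)) (evalF-cong V V′ ψ (agree ∘ ∈-++⁺ʳ (atoms φ)))
evalF-cong V V′ (φ f∨ ψ)  agree =
  cong₂ _∨_ (evalF-cong V V′ φ (agree ∘ ∈-++⁺ˡ)) (evalF-cong V V′ ψ (agree ∘ ∈-++⁺ʳ (atoms φ)))

_≟ᴾ_ : DecidableEquality PForm
pvar i   ≟ᴾ pvar j   = map′ (cong pvar) (λ { refl → refl }) (i ≟ j)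
p⊤       ≟ᴾ p⊤       = yes refl
p¬ a     ≟ᴾ p¬ b     = map′ (cong p¬) (λ { refl → refl }) (a ≟ᴾ b)
(a p∧ b) ≟ᴾ (c p∧ d) = map′ (λ { (refl , refl) → refl }) (λ { refl → refl , refl })
                              (a ≟ᴾ c ×-dec b ≟ᴾ d)
(a p∨ b) ≟ᴾ (c p∨ d) = map′ (λ { (refl , refl) → refl }) (λ { refl → refl , refl })
                              (a ≟ᴾ c ×-dec b ≟ᴾ d)
pvar _   ≟ᴾ p⊤       = no λ ()
pvar _   ≟ᴾ p¬ _     = no λ ()
pvar _   ≟ᴾ (_ p∧ _) = no λ ()
pvar _   ≟ᴾ (_ p∨ _) = no λ ()
p⊤       ≟ᴾ pvar _   = no λ ()
p⊤       ≟ᴾ p¬ _     = no λ ()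
p⊤       ≟ᴾ (_ p∧ _) = no λ ()
p⊤       ≟ᴾ (_ p∨ _) = no λ ()
p¬ _     ≟ᴾ pvar _   = no λ ()
p¬ _     ≟ᴾ p⊤       = no λ ()
p¬ _     ≟ᴾ (_ p∧ _) = no λ ()
p¬ _     ≟ᴾ (_ p∨ _) = no λ ()
(_ p∧ _) ≟ᴾ pvar _   = no λ ()
(_ p∧ _) ≟ᴾ p⊤       = no λ ()
(_ p∧ _) ≟ᴾ p¬ _     = no λ ()
(_ p∧ _) ≟ᴾ (_ p∨ _) = no λ ()
(_ p∨ _) ≟ᴾ pvar _   = no λ ()
(_ p∨ _) ≟ᴾ p⊤       = no λ ()
(_ p∨ _) ≟ᴾ p¬ _     = no λ ()
(_ p∨ _) ≟ᴾ (_ p∧ _) = no λ ()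

Sorted : List Lit → Set
Sorted = Linked (λ l l′ → proj₁ l < proj₁ l′)

Lint-≡ : (α α′ : Lint) → proj₁ α ≡ proj₁ α′ → α ≡ α′
Lint-≡ (ls , sorted) (.ls , sorted′) refl = cong (ls ,_) (Linked.irrelevant <-irrelevant sorted sorted′)

_≟ᴸ_ : DecidableEquality Lint
α ≟ᴸ α′ = map′ (Lint-≡ α α′) (cong proj₁)
                (List.≡-dec (Product.≡-dec _≟_ _≟ᵇ_) (proj₁ α) (proj₁ α′))

_≟ᵃ_ : DecidableEquality Atom
avar i   ≟ᵃ avar j     = map′ (cong avar) (λ { refl → refl }) (i ≟ j)
abox α β ≟ᵃ abox α′ β′ = map′ (λ { (refl , refl) → refl }) (λ { refl → refl , refl })
                                (α ≟ᴸ α′ ×-dec β ≟ᴾ β′)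
avar _   ≟ᵃ abox _ _   = no λ ()
abox _ _ ≟ᵃ avar _     = no λ ()

Assignment : Set
Assignment = List (Atom × Bool)

valueIn : Assignment → Atom → Bool
valueIn []             a = false
valueIn ((a′ , b) ∷ Γ) a = if does (a ≟ᵃ a′) then b else valueIn Γ a

valueIn-∈ : ∀ Γ {a b} → (a , b) ∈ Γ → (a , valueIn Γ a) ∈ Γ
valueIn-∈ ((a′ , b′) ∷ Γ) {a} a∈ with a ≟ᵃ a′ | a∈
... | yes refl | _          = here refl
... | no a≢a′  | here refl  = contradiction refl a≢a′
... | no _     | there a∈Γ  = there (valueIn-∈ Γ a∈Γ)

valuation : Assignment → Valuation
valuation Γ = record { vX = λ i → valueIn Γ (avar i) ; vBox = λ α β → valueIn Γ (abox α β) }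

evalF-valuation : ∀ Γ a → evalF (valuation Γ) ⌜ a ⌝ ≡ valueIn Γ a
evalF-valuation Γ (avar i)   = refl
evalF-valuation Γ (abox α β) = refl

Covers : Assignment → List Atom → Set
Covers Γ as = ∀ {a} → a ∈ as → Σ Bool λ b → (a , b) ∈ Γ

Truthful : Model → Assignment → Set
Truthful M Γ = ∀ {a b} → (a , b) ∈ Γ → (M ⊨ ⌜ a ⌝) ⇔ (b ≡ true)

¬¬-truth-value : (P : Set) → ¬ ¬ (Σ Bool λ b → P ⇔ (b ≡ true))
¬¬-truth-value P ¬tv =
  ¬tv (false , mk⇔ (λ p → ⊥-elim (¬tv (true , mk⇔ (λ _ → refl) (λ _ → p)))) (λ ()))

¬¬-truthful-assignment : ∀ M as → ¬ ¬ (Σ Assignment λ Γ → Truthful M Γ × Covers Γ as)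
¬¬-truthful-assignment M []       k = k ([] , (λ ()) , (λ ()))
¬¬-truthful-assignment M (a ∷ as) k =
  ¬¬-truth-value (M ⊨ ⌜ a ⌝) λ (b , a⇔b) → ¬¬-truthful-assignment M as λ (Γ , truthful , covers) →
  k ( (a , b) ∷ Γ
    , (λ { (here refl) → a⇔b ; (there e∈Γ) → truthful e∈Γ })
    , (λ { (here refl) → b , here refl ; (there a∈as) → map₂ there (covers a∈as) }))

tautology-valid : ∀ {φ} → Tautology φ → ∀ M → M ⊨ φ
tautology-valid {φ} taut M = ⊨-stable M φ λ ¬⊨φ →
  ¬¬-truthful-assignment M (atoms φ) λ (Γ , truthful , covers) →
  ¬⊨φ (from (truth-lemma M (valuation Γ) φ (atom⇔ Γ truthful covers)) (taut (valuation Γ)))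
  where
  atom⇔ : ∀ Γ → Truthful M Γ → Covers Γ (atoms φ) →
          ∀ {a} → a ∈ atoms φ → (M ⊨ ⌜ a ⌝) ⇔ (evalF (valuation Γ) ⌜ a ⌝ ≡ true)
  atom⇔ Γ truthful covers {a} a∈ =
    subst (λ b → (M ⊨ ⌜ a ⌝) ⇔ (b ≡ true)) (sym (evalF-valuation Γ a))
          (truthful (valueIn-∈ Γ (proj₂ (covers a∈))))

≡ᵇ-refl : ∀ n → (n ≡ᵇ n) ≡ true
≡ᵇ-refl zero    = refl
≡ᵇ-refl (suc n) = ≡ᵇ-refl n

≢⇒≡ᵇ-false : ∀ {m n} → m ≢ n → (m ≡ᵇ n) ≡ false
≢⇒≡ᵇ-false {zero}  {zero}  m≢n = contradiction refl m≢n
≢⇒≡ᵇ-false {zero}  {suc n} m≢n = refl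
≢⇒≡ᵇ-false {suc m} {zero}  m≢n = refl
≢⇒≡ᵇ-false {suc m} {suc n} m≢n = ≢⇒≡ᵇ-false (m≢n ∘ cong suc)

fixedBy-head : ∀ i b ls → fixedBy ((i , b) ∷ ls) i ≡ just b
fixedBy-head i b ls rewrite ≡ᵇ-refl i = refl

fixedBy-tail : ∀ {i n} b ls → i ≢ n → fixedBy ((i , b) ∷ ls) n ≡ fixedBy ls n
fixedBy-tail b ls i≢n rewrite ≢⇒≡ᵇ-false i≢n = refl

fixedBy-below : ∀ {i} l ls → Sorted (l ∷ ls) → i < proj₁ l → fixedBy (l ∷ ls) i ≡ nothing
fixedBy-below (j , c) []       _              i<j = fixedBy-tail {j} c [] λ { refl → <-irrefl refl i<j }
fixedBy-below (j , c) (l ∷ ls) (j<l ∷ sorted) i<j =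
  trans (fixedBy-tail {j} c (l ∷ ls) λ { refl → <-irrefl refl i<j })
        (fixedBy-below l ls sorted (<-trans i<j j<l))

fixedBy-after-head : ∀ i b ls → Sorted ((i , b) ∷ ls) → fixedBy ls i ≡ nothing
fixedBy-after-head i b []       _              = refl
fixedBy-after-head i b (l ∷ ls) (i<l ∷ sorted) = fixedBy-below l ls sorted i<l

Respects : List Lit → Tape → Set
Respects ls t = ∀ n b → fixedBy ls n ≡ just b → t n ≡ b

Respects-head : ∀ {t i b} ls → Respects ((i , b) ∷ ls) t → t i ≡ b
Respects-head {i = i} {b} ls resp = resp i b (fixedBy-head i b ls)

Respects-tail : ∀ {t i b} ls → Sorted ((i , b) ∷ ls) → Respects ((i , b) ∷ ls) t → Respects ls t
Respects-tail {i = i} {b} ls sorted resp n c fixed with i ≟ n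
... | yes refl = contradiction (trans (sym fixed) (fixedBy-after-head i b ls sorted)) λ ()
... | no i≢n   = resp n c (trans (fixedBy-tail b ls i≢n) fixed)

Respects-cons : ∀ {t i b} ls → t i ≡ b → Respects ls t → Respects ((i , b) ∷ ls) t
Respects-cons {i = i} {b} ls tᵢ≡b resp n c fixed with i ≟ n
... | yes refl = trans tᵢ≡b (just-injective (trans (sym (fixedBy-head i b ls)) fixed))
... | no i≢n   = resp n c (trans (sym (fixedBy-tail b ls i≢n)) fixed)

litP-true⇔ : ∀ t i b → (evalP t (litP (i , b)) ≡ true) ⇔ (t i ≡ b)
litP-true⇔ t i true  = mk⇔ (λ e → e) (λ e → e)
litP-true⇔ t i false with t i
... | true  = mk⇔ (λ ()) (λ ())
... | false = mk⇔ (λ _ → refl) (λ _ → refl)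

∧-true⇔ : ∀ {a b} → (a ∧ b ≡ true) ⇔ (a ≡ true × b ≡ true)
∧-true⇔ {true}  = mk⇔ (refl ,_) proj₂
∧-true⇔ {false} = mk⇔ (λ ()) (λ ())

conjP-true⇔ : ∀ ls t → Sorted ls → (evalP t (conjP ls) ≡ true) ⇔ Respects ls t
conjP-true⇔ []                 t _ = mk⇔ (λ _ n b ()) (λ _ → refl)
conjP-true⇔ ((i , b) ∷ [])     t _ =
  mk⇔ (λ lit → Respects-cons [] (to (litP-true⇔ t i b) lit) (λ n c ()))
      (λ resp → from (litP-true⇔ t i b) (Respects-head [] resp))
conjP-true⇔ ((i , b) ∷ l ∷ ls) t sorted@(_ ∷ sortedᵗ) =
  mk⇔ (λ conj → let lit , rest = to ∧-true⇔ conj in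
                Respects-cons (l ∷ ls) (to (litP-true⇔ t i b) lit)
                                       (to (conjP-true⇔ (l ∷ ls) t sortedᵗ) rest))
      (λ resp → from ∧-true⇔ ( from (litP-true⇔ t i b) (Respects-head (l ∷ ls) resp)
                             , from (conjP-true⇔ (l ∷ ls) t sortedᵗ) (Respects-tail (l ∷ ls) sorted resp)))

intP-true⇔ : ∀ α t → (evalP t (intP α) ≡ true) ⇔ Respects (proj₁ α) t
intP-true⇔ (ls , sorted) t = conjP-true⇔ ls t sorted

effective : Maybe Bool → Bool → Bool
effective (just c) _ = c
effective nothing  b = b

writeI-here : ∀ α p b t → Respects (proj₁ α) t → writeI α p b t p ≡ effective (fixedBy (proj₁ α) p) b
writeI-here α p b t resp with fixedBy (proj₁ α) p in fixed
... | just c  = resp p c fixed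
... | nothing rewrite ≡ᵇ-refl p = refl

writeI-elsewhere : ∀ α {p n} b t → n ≢ p → writeI α p b t n ≡ t n
writeI-elsewhere α {p} b t n≢p with fixedBy (proj₁ α) p
... | just _  = refl
... | nothing rewrite ≢⇒≡ᵇ-false n≢p = refl

setTape-respects : ∀ α x → Respects (proj₁ α) (setTape α x)
setTape-respects α x n b fixed with fixedBy (proj₁ α) n
setTape-respects α x n b refl | just .b = refl

writeI-respects : ∀ α p b t → Respects (proj₁ α) t → Respects (proj₁ α) (writeI α p b t)
writeI-respects α p b t resp n c fixed with n ≟ p
... | yes refl = trans (writeI-here α n b t resp) (cong (λ m → effective m b) fixed)
... | no n≢p   = trans (writeI-elsewhere α b t n≢p) (resp n c fixed)

HRun-respects : ∀ {T α c t} → Respects (proj₁ α) (Config.tape c) → HRun T α c t → Respects (proj₁ α) t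
HRun-respects resp (halted _) = resp
HRun-respects {α = α} {c} resp (step {o = _ , b , _} _ run) =
  HRun-respects (writeI-respects α (Config.pos c) b (Config.tape c) resp) run

HRun-output-satisfies : ∀ {T α x t} → HRun T α (initCfg T α x) t → evalP t (intP α) ≡ true
HRun-output-satisfies {α = α} {x} {t} run =
  from (intP-true⇔ α t) (HRun-respects (setTape-respects α x) run)

length≤1-∈ : ∀ {A : Set} (xs : List A) {x y} → length xs ≤ 1 → x ∈ xs → y ∈ xs → x ≡ y
length≤1-∈ (_ ∷ [])    _          (here refl) (here refl) = refl
length≤1-∈ (_ ∷ _ ∷ _) (s≤s ())   _           _

HRun-unique : ∀ {T α c t t′} → Deterministic T → HRun T α c t → HRun T α c t′ → t ≡ t′
HRun-unique det (halted _)         (halted _)          = refl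
HRun-unique det (halted none)      (step o∈ _)         = contradiction (subst (_ ∈_) none o∈) λ ()
HRun-unique det (step o∈ _)        (halted none)       = contradiction (subst (_ ∈_) none o∈) λ ()
HRun-unique {c = c} det (step o∈ run) (step o′∈ run′)
  with refl ← length≤1-∈ (options c) (det (Config.state c) (read c)) o∈ o′∈ = HRun-unique det run run′

AllHalt⇒HRun : ∀ {T α c} → AllHalt T α c → Σ Tape (HRun T α c)
AllHalt⇒HRun {c = c} (go allHalt) with options c in opts
... | []    = Config.tape c , halted opts
... | o ∷ _ = let (t , run) = AllHalt⇒HRun (allHalt (here refl))
              in t , step (subst (o ∈_) (sym opts) (here refl)) run

-- Soundness

varBound : PForm → ℕ
varBound (pvar i) = suc i
varBound p⊤       = 0
varBound (p¬ γ)   = varBound γ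
varBound (γ p∧ δ) = varBound γ ⊔ varBound δ
varBound (γ p∨ δ) = varBound γ ⊔ varBound δ

evalP-cong : ∀ γ v w → (∀ n → n < varBound γ → v n ≡ w n) → evalP v γ ≡ evalP w γ
evalP-cong (pvar i) v w agree = agree i ≤-refl
evalP-cong p⊤       v w agree = refl
evalP-cong (p¬ γ)   v w agree = cong not (evalP-cong γ v w agree)
evalP-cong (γ p∧ δ) v w agree =
  cong₂ _∧_ (evalP-cong γ v w λ n n< → agree n (<-≤-trans n< (m≤m⊔n _ _)))
            (evalP-cong δ v w λ n n< → agree n (<-≤-trans n< (m≤n⊔m _ _)))
evalP-cong (γ p∨ δ) v w agree =
  cong₂ _∨_ (evalP-cong γ v w λ n n< → agree n (<-≤-trans n< (m≤m⊔n _ _)))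
            (evalP-cong δ v w λ n n< → agree n (<-≤-trans n< (m≤n⊔m _ _)))

cutAt : ℕ → Tape → Tape
cutAt N t n with n <? N
... | yes _ = t n
... | no _  = false

truncate : Tape → ℕ → StateDesc
truncate t N = cutAt N t , N , beyond
  where
  beyond : ∀ n → N ≤ n → cutAt N t n ≡ false
  beyond n N≤n with n <? N
  ... | yes n<N = contradiction (<-≤-trans n<N N≤n) (<-irrefl refl)
  ... | no _    = refl

truncate-below : ∀ t {N n} → n < N → proj₁ (truncate t N) n ≡ t n
truncate-below t {N} {n} n<N with n <? N
... | yes _   = refl
... | no n≮N  = contradiction n<N n≮N

haltingTM : TM
haltingTM = record { nStates = 1 ; start = Fin.zero ; δ = λ _ _ → [] }

haltingTM-∈ : ∀ S x → InClass S (model haltingTM x)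
haltingTM-∈ (axsys _ _) x = (λ _ _ _ → z≤n) , (λ _ _ _ → go λ ())

⊨ι⇔evalP : ∀ M γ → (M ⊨ ι γ) ⇔ (evalP (proj₁ (Model.input M)) γ ≡ true)
⊨ι⇔evalP M (pvar i) = mk⇔ (λ e → e) (λ e → e)
⊨ι⇔evalP M p⊤       = mk⇔ (λ _ → refl) (λ _ → tt)
⊨ι⇔evalP M (p¬ γ)   = ¬-⇔ _ (⊨ι⇔evalP M γ)
⊨ι⇔evalP M (γ p∧ δ) = ×-⇔ _ _ (⊨ι⇔evalP M γ) (⊨ι⇔evalP M δ)
⊨ι⇔evalP M (γ p∨ δ) = ¬×¬-⇔ _ _ (⊨ι⇔evalP M γ) (⊨ι⇔evalP M δ)

-- A propositional formula only constrains the input tape, so the machine that halts at once suffices.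
valid-ι⇒tautology : ∀ S γ → Valid S (ι γ) → ∀ t → evalP t γ ≡ true
valid-ι⇒tautology S γ valid t =
  trans (evalP-cong γ t (proj₁ x) λ n n< → sym (truncate-below t n<))
        (to (⊨ι⇔evalP M γ) (valid M (haltingTM-∈ S x)))
  where
  x = truncate t (varBound γ)
  M = model haltingTM x

⇒-true : ∀ a b → not a ∨ b ≡ true → a ≡ true → b ≡ true
⇒-true true b a⇒b refl = a⇒b

true⇒not≢true : ∀ {b} → b ≡ true → not b ≢ true
true⇒not≢true refl ()

soundness : ∀ {S φ} → S ⊢ φ → Valid S φ
soundness (pc-taut taut) M _ = tautology-valid taut M
soundness (pc-mp {φ} {ψ} ⊢φ ⊢φ⇒ψ) M inClass =
  ⊨⇒-elim M φ ψ (soundness ⊢φ⇒ψ M inClass) (soundness ⊢φ M inClass)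
soundness {S} (rule-RW {α} {β} {β′} ⊢β⇒β′) M _ =
  ⊨⇒-intro M (box α β) (box α β′) λ ⊨β t run →
  ⇒-true (evalP t β) _ (valid-ι⇒tautology S (β p⇒ β′) (soundness ⊢β⇒β′) t) (⊨β t run)
soundness (ax-R {α}) M _ = λ t → HRun-output-satisfies
soundness (ax-K {α} {β} {γ}) M _ =
  ⊨⇒-intro M (box α (β p⇒ γ)) (box α β ⇒ box α γ) λ ⊨β⇒γ →
  ⊨⇒-intro M (box α β) (box α γ) λ ⊨β t run →
  ⇒-true (evalP t β) _ (⊨β⇒γ t run) (⊨β t run)
soundness {axsys _ _} (ax-F {α} {β} F∈S) M (det , _) =
  ⊨⇒-intro M (dia α β) (box α β) λ ⊨⟨⟩β t run →
  true-stable λ β≢true → ⊨⟨⟩β λ t′ run′ →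
  subst (λ u → not (evalP u β) ≡ true) (HRun-unique (det F∈S) run run′) (cong not (¬-not β≢true))
soundness {axsys _ _} (ax-D {α} {β} D∈S) M (_ , halts) =
  ⊨⇒-intro M (box α β) (dia α β) λ ⊨β ⊨¬β →
  let t , run = AllHalt⇒HRun (halts D∈S α (Model.input M))
  in contradiction (⊨¬β t run) (true⇒not≢true (⊨β t run))


bitAt : List Bool → Tape
bitAt []      n       = false
bitAt (b ∷ w) zero    = b
bitAt (b ∷ w) (suc n) = bitAt w n

∈-concatMap-at : ∀ {A B : Set} (f : A → List B) {x xs y} → x ∈ xs → y ∈ f x → y ∈ concatMap f xs
∈-concatMap-at f x∈ y∈ = ∈-concatMap⁺ f (Any.map (λ { refl → y∈ }) x∈)

words : ∀ {A : Set} → List A → ℕ → List (List A)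
words as zero    = [] ∷ []
words as (suc n) = concatMap (λ w → map (_∷ w) as) (words as n)

∈-words : ∀ {A : Set} {as : List A} → (∀ a → a ∈ as) → ∀ w → w ∈ words as (length w)
∈-words every []      = here refl
∈-words every (a ∷ w) = ∈-concatMap-at (λ w → map (_∷ w) _) (∈-words every w) (∈-map⁺ (_∷ w) (every a))

bitLists : ℕ → List (List Bool)
bitLists = words (true ∷ false ∷ [])

∈-bitLists : ∀ w → w ∈ bitLists (length w)
∈-bitLists = ∈-words λ { true → here refl ; false → there (here refl) }

bitAt-applyUpTo : ∀ v {N n} → n < N → bitAt (applyUpTo v N) n ≡ v n
bitAt-applyUpTo v {suc N} {zero}  _         = refl
bitAt-applyUpTo v {suc N} {suc n} (s≤s n<N) = bitAt-applyUpTo (v ∘ suc) n<N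

bitLists-complete : ∀ N (P : Tape → Set) → (∀ {v w} → (∀ n → n < N → v n ≡ w n) → P w → P v) →
                    (∀ {w} → w ∈ bitLists N → P (bitAt w)) → ∀ v → P v
bitLists-complete N P resp all-w v =
  resp (λ n n<N → sym (bitAt-applyUpTo v n<N))
       (all-w (subst (λ k → applyUpTo v N ∈ bitLists k) (length-applyUpTo v N) (∈-bitLists (applyUpTo v N))))

truthTable : PForm → Bool
truthTable γ = all (λ w → evalP (bitAt w) γ) (bitLists (varBound γ))

truthTable-sound : ∀ γ → T (truthTable γ) → ∀ v → evalP v γ ≡ true
truthTable-sound γ holds =
  bitLists-complete (varBound γ) (λ v → evalP v γ ≡ true)
    (λ {v} {w} agree γw → trans (evalP-cong γ v w agree) γw)
    (λ w∈ → Equivalence.to T-≡ (All.lookup (all⁺ _ _ holds) w∈))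

_‼_ : List Form → ℕ → Form
[]      ‼ _     = f⊤
(φ ∷ _) ‼ zero  = φ
(_ ∷ σ) ‼ suc i = σ ‼ i

_‼ᴾ_ : List PForm → ℕ → PForm
[]      ‼ᴾ _     = p⊤
(γ ∷ _) ‼ᴾ zero  = γ
(_ ∷ τ) ‼ᴾ suc i = τ ‼ᴾ i

-- `γ ⟨ σ ⟩` replaces each variable pvar i of the schema γ by the i-th entry of σ (⊤ past its end).
infix 30 _⟨_⟩ _⟨_⟩ᴾ

_⟨_⟩ : PForm → List Form → Form
pvar i   ⟨ σ ⟩ = σ ‼ i
p⊤       ⟨ σ ⟩ = f⊤
p¬ γ     ⟨ σ ⟩ = f¬ (γ ⟨ σ ⟩)
(γ p∧ δ) ⟨ σ ⟩ = γ ⟨ σ ⟩ f∧ δ ⟨ σ ⟩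
(γ p∨ δ) ⟨ σ ⟩ = γ ⟨ σ ⟩ f∨ δ ⟨ σ ⟩

_⟨_⟩ᴾ : PForm → List PForm → PForm
pvar i   ⟨ τ ⟩ᴾ = τ ‼ᴾ i
p⊤       ⟨ τ ⟩ᴾ = p⊤
p¬ γ     ⟨ τ ⟩ᴾ = p¬ (γ ⟨ τ ⟩ᴾ)
(γ p∧ δ) ⟨ τ ⟩ᴾ = γ ⟨ τ ⟩ᴾ p∧ δ ⟨ τ ⟩ᴾ
(γ p∨ δ) ⟨ τ ⟩ᴾ = γ ⟨ τ ⟩ᴾ p∨ δ ⟨ τ ⟩ᴾ

evalF-⟨⟩ : ∀ V γ σ → evalF V (γ ⟨ σ ⟩) ≡ evalP (λ i → evalF V (σ ‼ i)) γ
evalF-⟨⟩ V (pvar i) σ = refl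
evalF-⟨⟩ V p⊤       σ = refl
evalF-⟨⟩ V (p¬ γ)   σ = cong not (evalF-⟨⟩ V γ σ)
evalF-⟨⟩ V (γ p∧ δ) σ = cong₂ _∧_ (evalF-⟨⟩ V γ σ) (evalF-⟨⟩ V δ σ)
evalF-⟨⟩ V (γ p∨ δ) σ = cong₂ _∨_ (evalF-⟨⟩ V γ σ) (evalF-⟨⟩ V δ σ)

evalP-⟨⟩ᴾ : ∀ v γ τ → evalP v (γ ⟨ τ ⟩ᴾ) ≡ evalP (λ i → evalP v (τ ‼ᴾ i)) γ
evalP-⟨⟩ᴾ v (pvar i) τ = refl
evalP-⟨⟩ᴾ v p⊤       τ = refl
evalP-⟨⟩ᴾ v (p¬ γ)   τ = cong not (evalP-⟨⟩ᴾ v γ τ)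
evalP-⟨⟩ᴾ v (γ p∧ δ) τ = cong₂ _∧_ (evalP-⟨⟩ᴾ v γ τ) (evalP-⟨⟩ᴾ v δ τ)
evalP-⟨⟩ᴾ v (γ p∨ δ) τ = cong₂ _∨_ (evalP-⟨⟩ᴾ v γ τ) (evalP-⟨⟩ᴾ v δ τ)

evalF-ι : ∀ V γ → evalF V (ι γ) ≡ evalP (Valuation.vX V) γ
evalF-ι V (pvar i) = refl
evalF-ι V p⊤       = refl
evalF-ι V (p¬ γ)   = cong not (evalF-ι V γ)
evalF-ι V (γ p∧ δ) = cong₂ _∧_ (evalF-ι V γ) (evalF-ι V δ)
evalF-ι V (γ p∨ δ) = cong₂ _∨_ (evalF-ι V γ) (evalF-ι V δ)

p₀ p₁ p₂ p₃ p₄ : PForm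
p₀ = pvar 0
p₁ = pvar 1
p₂ = pvar 2
p₃ = pvar 3
p₄ = pvar 4

⊥ᶠ : Form
⊥ᶠ = f¬ f⊤

⊥ᴾ : PForm
⊥ᴾ = p¬ p⊤

⋀ ⋁ : List Form → Form
⋀ []       = f⊤
⋀ (φ ∷ φs) = φ f∧ ⋀ φs
⋁ []       = ⊥ᶠ
⋁ (φ ∷ φs) = φ f∨ ⋁ φs

⋀ᴾ ⋁ᴾ : List PForm → PForm
⋀ᴾ []       = p⊤
⋀ᴾ (γ ∷ γs) = γ p∧ ⋀ᴾ γs
⋁ᴾ []       = ⊥ᴾ
⋁ᴾ (γ ∷ γs) = γ p∨ ⋁ᴾ γs

module Derivations (S : AxSys) where

  -- For a concrete schema γ the implicit argument evaluates to ⊤, so Agda fills it in by itself.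
  ⊢-instance : ∀ γ {_ : T (truthTable γ)} σ → S ⊢ γ ⟨ σ ⟩
  ⊢-instance γ {holds} σ = pc-taut λ V → trans (evalF-⟨⟩ V γ σ) (truthTable-sound γ holds _)

  ⊢ι : ∀ {γ} → (∀ v → evalP v γ ≡ true) → S ⊢ ι γ
  ⊢ι {γ} holds = pc-taut λ V → trans (evalF-ι V γ) (holds _)

  ⊢ι-instance : ∀ γ {_ : T (truthTable γ)} τ → S ⊢ ι (γ ⟨ τ ⟩ᴾ)
  ⊢ι-instance γ {holds} τ = ⊢ι λ v → trans (evalP-⟨⟩ᴾ v γ τ) (truthTable-sound γ holds _)

  mp₂ : ∀ {A B C} → S ⊢ A → S ⊢ B → S ⊢ (A ⇒ (B ⇒ C)) → S ⊢ C
  mp₂ ⊢A ⊢B ⊢A⇒B⇒C = pc-mp ⊢B (pc-mp ⊢A ⊢A⇒B⇒C)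

  mp₃ : ∀ {A B C D} → S ⊢ A → S ⊢ B → S ⊢ C → S ⊢ (A ⇒ (B ⇒ (C ⇒ D))) → S ⊢ D
  mp₃ ⊢A ⊢B ⊢C ⊢A⇒B⇒C⇒D = pc-mp ⊢C (mp₂ ⊢A ⊢B ⊢A⇒B⇒C⇒D)

  ⇒-trans : ∀ {A B C} → S ⊢ (A ⇒ B) → S ⊢ (B ⇒ C) → S ⊢ (A ⇒ C)
  ⇒-trans {A} {B} {C} ⊢A⇒B ⊢B⇒C =
    mp₂ ⊢A⇒B ⊢B⇒C
        (⊢-instance ((p₀ p⇒ p₁) p⇒ ((p₁ p⇒ p₂) p⇒ (p₀ p⇒ p₂))) (A ∷ B ∷ C ∷ []))

  ⇒-weaken : ∀ {A} B → S ⊢ A → S ⊢ (B ⇒ A)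
  ⇒-weaken {A} B ⊢A = pc-mp ⊢A (⊢-instance (p₀ p⇒ (p₁ p⇒ p₀)) (A ∷ B ∷ []))

  box-of-consequence : ∀ {α γ} → S ⊢ ι (intP α p⇒ γ) → S ⊢ box α γ
  box-of-consequence ⊢α⇒γ = pc-mp ax-R (rule-RW ⊢α⇒γ)

  box-∧ : ∀ α a b → S ⊢ (box α a ⇒ (box α b ⇒ box α (a p∧ b)))
  box-∧ α a b =
    mp₂ (rule-RW (⊢ι-instance (p₀ p⇒ (p₁ p⇒ (p₀ p∧ p₁))) (a ∷ b ∷ []))) ax-K
        (⊢-instance ((p₀ p⇒ p₁) p⇒ ((p₁ p⇒ (p₂ p⇒ p₃)) p⇒ (p₀ p⇒ (p₂ p⇒ p₃))))
                    (box α a ∷ box α (b p⇒ (a p∧ b)) ∷ box α b ∷ box α (a p∧ b) ∷ []))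

  box-⋀ : ∀ α βs → S ⊢ (⋀ (map (box α) βs) ⇒ box α (intP α p∧ ⋀ᴾ βs))
  box-⋀ α [] = ⇒-weaken f⊤ (box-of-consequence (⊢ι-instance (p₀ p⇒ (p₀ p∧ p⊤)) (intP α ∷ [])))
  box-⋀ α (β ∷ βs) =
    mp₃ (box-⋀ α βs) (box-∧ α β (intP α p∧ ⋀ᴾ βs))
        (rule-RW (⊢ι-instance ((p₀ p∧ (p₁ p∧ p₂)) p⇒ (p₁ p∧ (p₀ p∧ p₂)))
                              (β ∷ intP α ∷ ⋀ᴾ βs ∷ [])))
        (⊢-instance ((p₁ p⇒ p₂) p⇒ ((p₀ p⇒ (p₂ p⇒ p₃)) p⇒
                      ((p₃ p⇒ p₄) p⇒ ((p₀ p∧ p₁) p⇒ p₄))))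
                    ( box α β ∷ ⋀ (map (box α) βs) ∷ box α (intP α p∧ ⋀ᴾ βs)
                    ∷ box α (β p∧ (intP α p∧ ⋀ᴾ βs)) ∷ box α (intP α p∧ (β p∧ ⋀ᴾ βs)) ∷ []))

  box-∨ : AxSys.withF S ≡ true → ∀ α a b → S ⊢ (box α (a p∨ b) ⇒ (box α a f∨ box α b))
  box-∨ F∈S α a b =
    mp₃ (rule-RW (⊢ι-instance ((p₀ p∨ p₁) p⇒ (p¬ p₀ p⇒ p₁)) (a ∷ b ∷ []))) ax-K (ax-F F∈S)
        (⊢-instance ((p₀ p⇒ p₁) p⇒ ((p₁ p⇒ (p₂ p⇒ p₃)) p⇒
                      ((p¬ p₂ p⇒ p₄) p⇒ (p₀ p⇒ (p₄ p∨ p₃)))))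
                    (box α (a p∨ b) ∷ box α (p¬ a p⇒ b) ∷ box α (p¬ a) ∷ box α b ∷ box α a ∷ []))

  box-⋁ : AxSys.withF S ≡ true → ∀ α βs →
          S ⊢ (box α (⋁ᴾ βs) ⇒ (⋁ (map (box α) βs) f∨ box α ⊥ᴾ))
  box-⋁ F∈S α []       = ⊢-instance (p₀ p⇒ (p₁ p∨ p₀)) (box α ⊥ᴾ ∷ ⊥ᶠ ∷ [])
  box-⋁ F∈S α (β ∷ βs) =
    mp₂ (box-∨ F∈S α β (⋁ᴾ βs)) (box-⋁ F∈S α βs)
        (⊢-instance ((p₀ p⇒ (p₁ p∨ p₂)) p⇒ ((p₂ p⇒ (p₃ p∨ p₄)) p⇒
                      (p₀ p⇒ ((p₁ p∨ p₃) p∨ p₄))))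
                    ( box α (β p∨ ⋁ᴾ βs) ∷ box α β ∷ box α (⋁ᴾ βs)
                    ∷ ⋁ (map (box α) βs) ∷ box α ⊥ᴾ ∷ []))

  box-⊥ : AxSys.withD S ≡ true → ∀ α → S ⊢ (box α ⊥ᴾ ⇒ ⊥ᶠ)
  box-⊥ D∈S α =
    mp₂ (ax-D D∈S) (box-of-consequence (⊢ι-instance (p₀ p⇒ p¬ (p¬ p⊤)) (intP α ∷ [])))
        (⊢-instance ((p₀ p⇒ p¬ p₁) p⇒ (p₁ p⇒ (p₀ p⇒ p¬ p⊤)))
                    (box α ⊥ᴾ ∷ box α (p¬ ⊥ᴾ) ∷ []))

  box-⊥-elim : ∀ α β → S ⊢ (box α ⊥ᴾ ⇒ box α β)
  box-⊥-elim α β = rule-RW (⊢ι-instance (p¬ p⊤ p⇒ p₀) (β ∷ []))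

Transition : Set → Set
Transition St = St × Bool × Move

-- Every control state outside `states` is encoded as index zero, which decodes to `start`.
module FiniteControl {St : Set} (_≟ˢ_ : DecidableEquality St) (states : List St) (start : St)
                     (δ : St → Bool → List (Transition St)) where

  open DecMembership _≟ˢ_ using (_∈?_)

  encode : St → Fin (suc (length states))
  encode s with s ∈? states
  ... | yes s∈ = Fin.suc (index s∈)
  ... | no _   = Fin.zero

  decode : Fin (suc (length states)) → St
  decode Fin.zero    = start
  decode (Fin.suc k) = lookup states k

  decode-encode : ∀ {s} → s ∈ states → decode (encode s) ≡ s
  decode-encode {s} s∈ with s ∈? states
  ... | yes s∈′ = sym (lookup-index s∈′)
  ... | no s∉   = contradiction s∈ s∉

  encodeTransition : Transition St → Transition (Fin (suc (length states)))
  encodeTransition (s , b , m) = encode s , b , m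

  machine : TM
  machine = record { nStates = suc (length states) ; start = encode start
                   ; δ = λ q b → map encodeTransition (δ (decode q) b) }

  at : St → ℕ → Tape → Config machine
  at s p t = cfg (encode s) p t

  options-at : ∀ {s} p t → s ∈ states → options (at s p t) ≡ map encodeTransition (δ s (t p))
  options-at {s} p t s∈ = cong (λ s′ → map encodeTransition (δ s′ (t p))) (decode-encode s∈)

  machine-deterministic : (∀ s b → length (δ s b) ≤ 1) → Deterministic machine
  machine-deterministic δ≤1 q b =
    subst (_≤ 1) (sym (length-map encodeTransition (δ (decode q) b))) (δ≤1 (decode q) b)

record Forced (T : TM) (α : Lint) (c c′ : Config T) : Set where
  field
    forward  : ∀ {t} → HRun T α c t → HRun T α c′ t
    backward : ∀ {t} → HRun T α c′ t → HRun T α c t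
    halts    : AllHalt T α c′ → AllHalt T α c

Forced-refl : ∀ {T α c} → Forced T α c c
Forced-refl = record { forward = λ run → run ; backward = λ run → run ; halts = λ h → h }

Forced-trans : ∀ {T α c c′ c″} → Forced T α c c′ → Forced T α c′ c″ → Forced T α c c″
Forced-trans F G = record
  { forward  = Forced.forward G ∘ Forced.forward F
  ; backward = Forced.backward F ∘ Forced.backward G
  ; halts    = Forced.halts F ∘ Forced.halts G }

forced-step : ∀ {T α c o} → options c ≡ o ∷ [] → Forced T α c (next α c o)
forced-step {T} {α} {c} {o} only-o = record { forward = forward ; backward = backward ; halts = halts }
  where
  only : ∀ {o′} → o′ ∈ options c → o′ ≡ o
  only o′∈ with here o′≡o ← subst (_ ∈_) only-o o′∈ = o′≡o
  forward : ∀ {t} → HRun T α c t → HRun T α (next α c o) t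
  forward (halted none)   = contradiction (trans (sym none) only-o) λ ()
  forward (step o′∈ run) with refl ← only o′∈ = run
  backward : ∀ {t} → HRun T α (next α c o) t → HRun T α c t
  backward = step (subst (o ∈_) (sym only-o) (here refl))
  halts : AllHalt T α (next α c o) → AllHalt T α c
  halts h = go λ o′∈ → subst (λ o′ → AllHalt T α (next α c o′)) (sym (only o′∈)) h

HRun-halted : ∀ {T α c t} → options c ≡ [] → HRun T α c t → t ≡ Config.tape c
HRun-halted none (halted _)   = refl
HRun-halted none (step o∈ _)  = contradiction (subst (_ ∈_) none o∈) λ ()

AllHalt-halted : ∀ {T α c} → options c ≡ [] → AllHalt T α c
AllHalt-halted none = go λ o∈ → contradiction (subst (_ ∈_) none o∈) λ ()

-- The probing machine

Profile : Set
Profile = List (Maybe Bool)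

Output : Set
Output = List Bool

Table : Set
Table = List (Profile × List Output)

profile : Lint → ℕ → Profile
profile α zero    = []
profile α (suc i) = fixedBy (proj₁ α) i ∷ profile α i

allProfiles : ℕ → List Profile
allProfiles = words (just true ∷ just false ∷ nothing ∷ [])

∈-allProfiles : ∀ l → l ∈ allProfiles (length l)
∈-allProfiles = ∈-words λ { (just true) → here refl ; (just false) → there (here refl)
                          ; nothing → there (there (here refl)) }

_≟ᵖ_ : DecidableEquality Profile
_≟ᵖ_ = List.≡-dec (Maybe.≡-dec _≟ᵇ_)

length-profile : ∀ α i → length (profile α i) ≡ i
length-profile α zero    = refl
length-profile α (suc i) = cong suc (length-profile α i)

lookupRow : Profile → Table → Maybe (List Output)
lookupRow l []               = nothing
lookupRow l ((l′ , ws) ∷ tb) with l ≟ᵖ l′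
... | yes _ = just ws
... | no _  = lookupRow l tb

lookupRow-∈ : ∀ l tb {ws} → lookupRow l tb ≡ just ws → (l , ws) ∈ tb
lookupRow-∈ l ((l′ , ws′) ∷ tb) found with l ≟ᵖ l′
lookupRow-∈ l ((l′ , ws′) ∷ tb) refl  | yes refl = here refl
lookupRow-∈ l ((l′ , ws′) ∷ tb) found | no _     = there (lookupRow-∈ l tb found)

-- A cell that held b and still reads b after ¬ b was written to it is fixed by the intervention.
probeResult : Bool → Bool → Maybe Bool
probeResult true  true  = just true
probeResult false false = just false
probeResult _     _     = nothing

data Control : Set where
  probe   : ℕ → Profile → Control
  probed  : ℕ → Profile → Bool → Control
  recheck : ℕ → Profile → Bool → Control
  rewind  : ℕ → Output → Control
  emit    : ℕ → Output → Control
  diverge : Control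

private
  Code : Set
  Code = ℕ × ℕ × Profile × Bool × Output

  code : Control → Code
  code (probe i l)     = 0 , i , l , false , []
  code (probed i l b)  = 1 , i , l , b , []
  code (recheck i l b) = 2 , i , l , b , []
  code (rewind k w)    = 3 , k , [] , false , w
  code (emit i w)      = 4 , i , [] , false , w
  code diverge         = 5 , 0 , [] , false , []

  uncode : Code → Control
  uncode (0 , i , l , b , w) = probe i l
  uncode (1 , i , l , b , w) = probed i l b
  uncode (2 , i , l , b , w) = recheck i l b
  uncode (3 , k , l , b , w) = rewind k w
  uncode (4 , i , l , b , w) = emit i w
  uncode _                   = diverge

  uncode-code : ∀ s → uncode (code s) ≡ s
  uncode-code (probe i l)     = refl
  uncode-code (probed i l b)  = refl
  uncode-code (recheck i l b) = refl
  uncode-code (rewind k w)    = refl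
  uncode-code (emit i w)      = refl
  uncode-code diverge         = refl

  _≟ᶜᵒᵈᵉ_ : DecidableEquality Code
  _≟ᶜᵒᵈᵉ_ = Product.≡-dec _≟_ (Product.≡-dec _≟_ (Product.≡-dec _≟ᵖ_
              (Product.≡-dec _≟ᵇ_ (List.≡-dec _≟ᵇ_))))

_≟ᶜ_ : DecidableEquality Control
s ≟ᶜ s′ = map′ (λ e → trans (sym (uncode-code s)) (trans (cong uncode e) (uncode-code s′))) (cong code)
               (code s ≟ᶜᵒᵈᵉ code s′)

module ProbeMachine (N : ℕ) (table : Table) where

  outputs : List Output
  outputs = concatMap proj₂ table

  branches : List Output → Bool → List (Transition Control)
  branches []       b = (diverge , b , right) ∷ []
  branches (w ∷ ws) b = map (λ w′ → rewind (suc N) w′ , b , right) (w ∷ ws)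

  choose : Profile → Bool → List (Transition Control)
  choose l b with lookupRow l table
  ... | nothing = []
  ... | just ws = branches ws b

  choose-found : ∀ {l ws} b → lookupRow l table ≡ just ws → choose l b ≡ branches ws b
  choose-found {l} b found with lookupRow l table
  choose-found b refl | just _ = refl

  choose-missing : ∀ {l} b → lookupRow l table ≡ nothing → choose l b ≡ []
  choose-missing {l} b missing with lookupRow l table
  choose-missing b refl | nothing = refl

  output-∈ : ∀ {l ws w} → lookupRow l table ≡ just ws → w ∈ ws → w ∈ outputs
  output-∈ {l} found w∈ = ∈-concatMap-at proj₂ (lookupRow-∈ l table found) w∈

  δ : Control → Bool → List (Transition Control)
  δ (probe i l) b with i <? N
  ... | yes _ = (probed i l b , not b , right) ∷ []
  ... | no _  = choose l b
  δ (probed i l b)  c  = (recheck i l b , c , left) ∷ []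
  δ (recheck i l b) b′ = (probe (suc i) (probeResult b b′ ∷ l) , b′ , right) ∷ []
  δ (rewind zero w)    b = (emit 0 w , b , left) ∷ []     -- a left move at cell 0 stays there
  δ (rewind (suc k) w) b = (rewind k w , b , left) ∷ []
  δ (emit i w) b with i <? N
  ... | yes _ = (emit (suc i) w , bitAt w i , right) ∷ []
  ... | no _  = []
  δ diverge b = (diverge , b , right) ∷ []

  probedWith : ℕ → Profile → List Control
  probedWith i l = probed i l true ∷ probed i l false ∷ recheck i l true ∷ recheck i l false ∷ []

  probesAt probedAt rewindsAt emitsAt : ℕ → List Control
  probesAt i  = map (probe i) (allProfiles i)
  probedAt i  = concatMap (probedWith i) (allProfiles i)
  rewindsAt k = map (rewind k) outputs
  emitsAt i   = map (emit i) outputs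

  probeStates probedStates rewindStates emitStates states : List Control
  probeStates  = concatMap probesAt (downFrom (suc N))
  probedStates = concatMap probedAt (downFrom N)
  rewindStates = concatMap rewindsAt (downFrom (suc (suc N)))
  emitStates   = concatMap emitsAt (downFrom (suc N))
  states       = probeStates ++ probedStates ++ rewindStates ++ emitStates ++ diverge ∷ []

  open FiniteControl _≟ᶜ_ states (probe 0 []) δ public
    using (machine; at; options-at; machine-deterministic; encodeTransition)

  probe-∈ : ∀ {i} l → i ≤ N → length l ≡ i → probe i l ∈ states
  probe-∈ l i≤N refl =
    ∈-++⁺ˡ (∈-concatMap-at probesAt (∈-downFrom⁺ (s≤s i≤N)) (∈-map⁺ (probe _) (∈-allProfiles l)))

  private
    probedAt-∈ : ∀ {i s} l → i < N → length l ≡ i → s ∈ probedWith i l → s ∈ states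
    probedAt-∈ l i<N refl s∈ =
      ∈-++⁺ʳ probeStates (∈-++⁺ˡ (∈-concatMap-at probedAt (∈-downFrom⁺ i<N)
                                   (∈-concatMap-at (probedWith _) (∈-allProfiles l) s∈)))

  probed-∈ : ∀ {i} l b → i < N → length l ≡ i → probed i l b ∈ states
  probed-∈ l true  i<N l≡i = probedAt-∈ l i<N l≡i (here refl)
  probed-∈ l false i<N l≡i = probedAt-∈ l i<N l≡i (there (here refl))

  recheck-∈ : ∀ {i} l b → i < N → length l ≡ i → recheck i l b ∈ states
  recheck-∈ l true  i<N l≡i = probedAt-∈ l i<N l≡i (there (there (here refl)))
  recheck-∈ l false i<N l≡i = probedAt-∈ l i<N l≡i (there (there (there (here refl))))

  rewind-∈ : ∀ {k w} → k ≤ suc N → w ∈ outputs → rewind k w ∈ states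
  rewind-∈ k≤ w∈ = ∈-++⁺ʳ probeStates (∈-++⁺ʳ probedStates (∈-++⁺ˡ
                     (∈-concatMap-at rewindsAt (∈-downFrom⁺ (s≤s k≤)) (∈-map⁺ (rewind _) w∈))))

  emit-∈ : ∀ {i w} → i ≤ N → w ∈ outputs → emit i w ∈ states
  emit-∈ i≤N w∈ = ∈-++⁺ʳ probeStates (∈-++⁺ʳ probedStates (∈-++⁺ʳ rewindStates (∈-++⁺ˡ
                    (∈-concatMap-at emitsAt (∈-downFrom⁺ (s≤s i≤N)) (∈-map⁺ (emit _) w∈)))))

  diverge-∈ : diverge ∈ states
  diverge-∈ =
    ∈-++⁺ʳ probeStates (∈-++⁺ʳ probedStates (∈-++⁺ʳ rewindStates (∈-++⁺ʳ emitStates (here refl))))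

  δ-probe< : ∀ {i} l b → i < N → δ (probe i l) b ≡ (probed i l b , not b , right) ∷ []
  δ-probe< {i} l b i<N with i <? N
  ... | yes _  = refl
  ... | no i≮N = contradiction i<N i≮N

  δ-probe-N : ∀ l b → δ (probe N l) b ≡ choose l b
  δ-probe-N l b with N <? N
  ... | yes N<N = contradiction N<N (<-irrefl refl)
  ... | no _    = refl

  δ-emit< : ∀ {i} w b → i < N → δ (emit i w) b ≡ (emit (suc i) w , bitAt w i , right) ∷ []
  δ-emit< {i} w b i<N with i <? N
  ... | yes _  = refl
  ... | no i≮N = contradiction i<N i≮N

  δ-emit-N : ∀ w b → δ (emit N w) b ≡ []
  δ-emit-N w b with N <? N
  ... | yes N<N = contradiction N<N (<-irrefl refl)
  ... | no _    = refl

  choose-length≤1 : (∀ {row} → row ∈ table → length (proj₂ row) ≤ 1) → ∀ l b → length (choose l b) ≤ 1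
  choose-length≤1 rows≤1 l b with lookupRow l table in found
  ... | nothing       = z≤n
  ... | just []       = s≤s z≤n
  ... | just (w ∷ ws) = subst (_≤ 1) (sym (length-map _ (w ∷ ws))) (rows≤1 (lookupRow-∈ l table found))

  δ-length≤1 : (∀ {row} → row ∈ table → length (proj₂ row) ≤ 1) → ∀ s b → length (δ s b) ≤ 1
  δ-length≤1 rows≤1 (probe i l) b with i <? N
  ... | yes _ = s≤s z≤n
  ... | no _  = choose-length≤1 rows≤1 l b
  δ-length≤1 rows≤1 (probed i l c)     b = s≤s z≤n
  δ-length≤1 rows≤1 (recheck i l c)    b = s≤s z≤n
  δ-length≤1 rows≤1 (rewind zero w)    b = s≤s z≤n
  δ-length≤1 rows≤1 (rewind (suc k) w) b = s≤s z≤n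
  δ-length≤1 rows≤1 (emit i w) b with i <? N
  ... | yes _ = s≤s z≤n
  ... | no _  = z≤n
  δ-length≤1 rows≤1 diverge b = s≤s z≤n

  probeResult-same : ∀ b → probeResult b b ≡ just b
  probeResult-same true  = refl
  probeResult-same false = refl

  probeResult-effective : ∀ b m → (∀ c → m ≡ just c → b ≡ c) → probeResult b (effective m (not b)) ≡ m
  probeResult-effective b     (just c) fixed rewrite fixed c refl = probeResult-same c
  probeResult-effective true  nothing  _     = refl
  probeResult-effective false nothing  _     = refl

  module Run (α : Lint) where

    f : ℕ → Maybe Bool
    f = fixedBy (proj₁ α)

    R : Tape → Set
    R = Respects (proj₁ α)

    step-at : ∀ {s s′ b m} p t → s ∈ states → δ s (t p) ≡ (s′ , b , m) ∷ [] →
              Forced machine α (at s p t) (at s′ (move m p) (writeI α p b t))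
    step-at p t s∈ δ≡ = forced-step (trans (options-at p t s∈) (cong (map encodeTransition) δ≡))

    probe-step : ∀ {i} t → i < N → R t →
                 Σ Tape λ t′ → R t′ × Forced machine α (at (probe i (profile α i)) i t)
                                                       (at (probe (suc i) (profile α (suc i))) (suc i) t′)
    probe-step {i} t i<N resp = t₃ , resp₃ , Forced-trans first (Forced-trans second third)
      where
      l  = profile α i
      b  = t i
      t₁ = writeI α i (not b) t
      t₂ = writeI α (suc i) (t₁ (suc i)) t₁
      t₃ = writeI α i (t₂ i) t₂
      resp₃ : R t₃
      resp₃ = writeI-respects α i _ t₂ (writeI-respects α (suc i) _ t₁ (writeI-respects α i (not b) t resp))
      detects : probeResult b (t₂ i) ≡ f i
      detects = trans (cong (probeResult b) (trans (writeI-elsewhere α _ t₁ (λ ()))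
                                                   (writeI-here α i (not b) t resp)))
                      (probeResult-effective b (f i) (λ c fixed → resp i c fixed))
      first  = step-at i t (probe-∈ l (≤-trans (n≤1+n i) i<N) (length-profile α i)) (δ-probe< l b i<N)
      second = step-at (suc i) t₁ (probed-∈ l b i<N (length-profile α i)) refl
      third : Forced machine α (at (recheck i l b) i t₂) (at (probe (suc i) (profile α (suc i))) (suc i) t₃)
      third = subst (λ m → Forced machine α (at (recheck i l b) i t₂) (at (probe (suc i) (m ∷ l)) (suc i) t₃))
                    detects (step-at i t₂ (recheck-∈ l b i<N (length-profile α i)) refl)

    probe-phase : ∀ k {i} t → k + i ≡ N → R t →
                  Σ Tape λ t′ → R t′ × Forced machine α (at (probe i (profile α i)) i t)
                                                       (at (probe N (profile α N)) N t′)
    probe-phase zero    t refl resp = t , resp , Forced-refl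
    probe-phase (suc k) {i} t k+i≡N resp
      with t₁ , resp₁ , F ← probe-step t (subst (i <_) k+i≡N (s≤s (m≤n+m i k))) resp
      with t′ , resp′ , G ← probe-phase k t₁ (trans (+-suc k i) k+i≡N) resp₁
      = t′ , resp′ , Forced-trans F G

    rewind-phase : ∀ k {w} t → k ≤ suc N → w ∈ outputs → R t →
                   Σ Tape λ t′ → R t′ × Forced machine α (at (rewind k w) k t) (at (emit 0 w) 0 t′)
    rewind-phase zero    t _   w∈ resp =
      _ , writeI-respects α 0 _ t resp , step-at 0 t (rewind-∈ z≤n w∈) refl
    rewind-phase (suc k) t k<N w∈ resp
      with t′ , resp′ , F ← rewind-phase k _ (≤-trans (n≤1+n k) k<N) w∈
                                             (writeI-respects α (suc k) _ t resp)
      = t′ , resp′ , Forced-trans (step-at (suc k) t (rewind-∈ k<N w∈) refl) F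

    emit-phase : ∀ k {i w} t → k + i ≡ N → w ∈ outputs → R t →
                 Σ Tape λ t′ → (∀ n → n < i → t′ n ≡ t n)
                             × (∀ n → i ≤ n → n < N → t′ n ≡ effective (f n) (bitAt w n))
                             × Forced machine α (at (emit i w) i t) (at (emit N w) N t′)
    emit-phase zero t refl w∈ resp =
      t , (λ _ _ → refl) , (λ n N≤n n<N → contradiction (<-≤-trans n<N N≤n) (<-irrefl refl)) , Forced-refl
    emit-phase (suc k) {i} {w} t k+i≡N w∈ resp
      with t′ , below , above , F ← emit-phase k (writeI α i (bitAt w i) t) (trans (+-suc k i) k+i≡N) w∈
                                               (writeI-respects α i _ t resp)
      = t′ , below′ , above′
      , Forced-trans (step-at i t (emit-∈ (≤-trans (n≤1+n i) i<N) w∈) (δ-emit< w (t i) i<N)) F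
      where
      i<N : i < N
      i<N = subst (i <_) k+i≡N (s≤s (m≤n+m i k))
      below′ : ∀ n → n < i → t′ n ≡ t n
      below′ n n<i = trans (below n (≤-trans n<i (n≤1+n i)))
                           (writeI-elsewhere α _ t (λ n≡i → <-irrefl n≡i n<i))
      above′ : ∀ n → i ≤ n → n < N → t′ n ≡ effective (f n) (bitAt w n)
      above′ n i≤n n<N with n ≟ i
      ... | yes refl = trans (below n ≤-refl) (writeI-here α n _ t resp)
      ... | no n≢i   = above n (≤∧≢⇒< i≤n (n≢i ∘ sym)) n<N

    output-phase : ∀ {w} t → w ∈ outputs → R t →
                   Σ Tape λ t′ → (∀ n → n < N → t′ n ≡ effective (f n) (bitAt w n))
                               × Forced machine α (at (rewind (suc N) w) (suc N) t) (at (emit N w) N t′)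
    output-phase t w∈ resp
      with t₁ , resp₁ , F ← rewind-phase (suc N) t ≤-refl w∈ resp
      with t′ , _ , above , G ← emit-phase N t₁ (+-identityʳ N) w∈ resp₁
      = t′ , (λ n → above n z≤n) , Forced-trans F G

    emit-N-halts : ∀ {w} t → w ∈ outputs → options (at (emit N w) N t) ≡ []
    emit-N-halts {w} t w∈ =
      trans (options-at N t (emit-∈ ≤-refl w∈)) (cong (map encodeTransition) (δ-emit-N w (t N)))

    diverge-¬HRun : ∀ p t {t′} → ¬ HRun machine α (at diverge p t) t′
    diverge-¬HRun p t (halted none) = contradiction (trans (sym none) (options-at p t diverge-∈)) λ ()
    diverge-¬HRun p t (step o∈ run)
      with here refl ← subst (_ ∈_) (options-at p t diverge-∈) o∈ = diverge-¬HRun (suc p) _ run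

    module FromInput (x : Tape) where

      probing : Σ Tape λ t → R t × Forced machine α (initCfg machine α x) (at (probe N (profile α N)) N t)
      probing = probe-phase N (setTape α x) (+-identityʳ N) (setTape-respects α x)

      probedTape : Tape
      probedTape = proj₁ probing

      decision : Config machine
      decision = at (probe N (profile α N)) N probedTape

      toDecision : Forced machine α (initCfg machine α x) decision
      toDecision = proj₂ (proj₂ probing)

      branch : Output → Transition Control
      branch w = rewind (suc N) w , probedTape N , right

      afterDecision : Tape
      afterDecision = writeI α N (probedTape N) probedTape

      output-run : ∀ {w} → w ∈ outputs →
                   Σ Tape λ t′ → (∀ n → n < N → t′ n ≡ effective (f n) (bitAt w n))
                               × Forced machine α (next α decision (encodeTransition (branch w)))
                                                  (at (emit N w) N t′)
      output-run w∈ = output-phase afterDecision w∈ (writeI-respects α N _ probedTape (proj₁ (proj₂ probing)))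

      options-decision : options decision ≡ map encodeTransition (choose (profile α N) (probedTape N))
      options-decision = trans (options-at N probedTape (probe-∈ (profile α N) ≤-refl (length-profile α N)))
                               (cong (map encodeTransition) (δ-probe-N _ _))

      options-missing : lookupRow (profile α N) table ≡ nothing → options decision ≡ []
      options-missing missing = trans options-decision (cong (map encodeTransition) (choose-missing _ missing))

      options-found : ∀ {ws} → lookupRow (profile α N) table ≡ just ws →
                      options decision ≡ map encodeTransition (branches ws (probedTape N))
      options-found found = trans options-decision (cong (map encodeTransition) (choose-found _ found))

      branch-∈⁻ : ∀ {w ws o} → o ∈ map encodeTransition (branches (w ∷ ws) (probedTape N)) →
                  Σ Output λ w′ → w′ ∈ w ∷ ws × o ≡ encodeTransition (branch w′)
      branch-∈⁻ o∈
        with _ , o′∈ , refl ← ∈-map⁻ encodeTransition o∈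
        with w′ , w′∈ , refl ← ∈-map⁻ branch o′∈
        = w′ , w′∈ , refl

      HRun⇒output : ∀ {ws t} → lookupRow (profile α N) table ≡ just ws →
                    HRun machine α (initCfg machine α x) t →
                    Σ Output λ w → w ∈ ws × (∀ n → n < N → t n ≡ effective (f n) (bitAt w n))
      HRun⇒output {[]} found run =
        contradiction (Forced.forward (forced-step (options-found found)) (Forced.forward toDecision run))
                      (diverge-¬HRun _ _)
      HRun⇒output {w ∷ ws} found run with Forced.forward toDecision run
      ... | halted none = contradiction (trans (sym none) (options-found found)) λ ()
      ... | step o∈ run′
        with w′ , w′∈ , refl ← branch-∈⁻ (subst (_ ∈_) (options-found found) o∈)
        with t′ , agrees , F ← output-run (output-∈ found w′∈)
        with refl ← HRun-halted (emit-N-halts t′ (output-∈ found w′∈)) (Forced.forward F run′)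
        = w′ , w′∈ , agrees

      output⇒HRun : ∀ {ws w} → lookupRow (profile α N) table ≡ just ws → w ∈ ws →
                    Σ Tape λ t → HRun machine α (initCfg machine α x) t
                               × (∀ n → n < N → t n ≡ effective (f n) (bitAt w n))
      output⇒HRun {w′ ∷ ws} {w} found w∈
        with t′ , agrees , F ← output-run (output-∈ found w∈)
        = t′ , Forced.backward toDecision (step choice (Forced.backward F (halted halts-at-end))) , agrees
        where
        halts-at-end = emit-N-halts t′ (output-∈ found w∈)
        choice : encodeTransition (branch w) ∈ options decision
        choice = subst (encodeTransition (branch w) ∈_) (sym (options-found found))
                       (∈-map⁺ encodeTransition (∈-map⁺ branch w∈))

      halts : (∀ {row} → row ∈ table → proj₂ row ≢ []) → AllHalt machine α (initCfg machine α x)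
      halts rows≢[] with lookupRow (profile α N) table in found
      ... | nothing       = Forced.halts toDecision (AllHalt-halted (options-missing found))
      ... | just []       = contradiction refl (rows≢[] (lookupRow-∈ _ table found))
      ... | just (w ∷ ws) = Forced.halts toDecision (go branch-halts)
        where
        branch-halts : ∀ {o} → o ∈ options decision → AllHalt machine α (next α decision o)
        branch-halts o∈
          with w′ , w′∈ , refl ← branch-∈⁻ (subst (_ ∈_) (options-found found) o∈)
          with t′ , _ , F ← output-run (output-∈ found w′∈)
          = Forced.halts F (AllHalt-halted (emit-N-halts t′ (output-∈ found w′∈)))

-- Completeness

litBound : List Lit → ℕ
litBound []             = 0
litBound ((i , _) ∷ ls) = suc i ⊔ litBound ls

fixedBy-beyond : ∀ ls {n} → litBound ls ≤ n → fixedBy ls n ≡ nothing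
fixedBy-beyond []             _     = refl
fixedBy-beyond ((i , b) ∷ ls) bound =
  trans (fixedBy-tail {i} b ls λ { refl → <-irrefl refl (≤-trans (m≤m⊔n (suc i) (litBound ls)) bound) })
        (fixedBy-beyond ls (≤-trans (m≤n⊔m (suc i) (litBound ls)) bound))

varBound-litP : ∀ i b → varBound (litP (i , b)) ≡ suc i
varBound-litP i true  = refl
varBound-litP i false = refl

varBound-conjP : ∀ ls → varBound (conjP ls) ≤ litBound ls
varBound-conjP []                 = z≤n
varBound-conjP ((i , b) ∷ [])     = subst (_≤ suc i ⊔ 0) (sym (varBound-litP i b)) (m≤m⊔n (suc i) 0)
varBound-conjP ((i , b) ∷ l ∷ ls) =
  ⊔-mono-≤ (subst (_≤ suc i) (sym (varBound-litP i b)) ≤-refl) (varBound-conjP (l ∷ ls))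

profile-agrees : ∀ {α α′ N n} → profile α N ≡ profile α′ N → n < N →
                 fixedBy (proj₁ α) n ≡ fixedBy (proj₁ α′) n
profile-agrees {N = suc N} {n} same n<N with n ≟ N
... | yes refl = cong (λ { [] → nothing ; (m ∷ _) → m }) same
... | no n≢N   = profile-agrees (cong (λ { [] → [] ; (_ ∷ l) → l }) same) (≤∧≢⇒< (≤-pred n<N) n≢N)

fixedBy-injective : ∀ ls ls′ → Sorted ls → Sorted ls′ → (∀ n → fixedBy ls n ≡ fixedBy ls′ n) →
                    ls ≡ ls′
fixedBy-injective []             []              _ _ _ = refl
fixedBy-injective []             ((j , c) ∷ ls′) _ _ same =
  contradiction (trans (same j) (fixedBy-head j c ls′)) λ ()
fixedBy-injective ((i , b) ∷ ls) []              _ _ same =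
  contradiction (trans (sym (same i)) (fixedBy-head i b ls)) λ ()
fixedBy-injective ((i , b) ∷ ls) ((j , c) ∷ ls′) sorted sorted′ same with <-cmp i j
... | tri< i<j _ _ =
  contradiction (trans (sym (fixedBy-head i b ls)) (trans (same i) (fixedBy-below (j , c) ls′ sorted′ i<j))) λ ()
... | tri> _ _ j<i =
  contradiction (trans (sym (fixedBy-head j c ls′)) (trans (sym (same j)) (fixedBy-below (i , b) ls sorted j<i))) λ ()
... | tri≈ _ refl _
  with refl ← just-injective (trans (sym (fixedBy-head i b ls)) (trans (same i) (fixedBy-head i c ls′))) =
  cong ((i , b) ∷_) (fixedBy-injective ls ls′ (Linked.tail sorted) (Linked.tail sorted′) same-tail)
  where
  same-tail : ∀ n → fixedBy ls n ≡ fixedBy ls′ n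
  same-tail n with i ≟ n
  ... | yes refl = trans (fixedBy-after-head i b ls sorted) (sym (fixedBy-after-head i b ls′ sorted′))
  ... | no i≢n   = trans (sym (fixedBy-tail b ls i≢n)) (trans (same n) (fixedBy-tail b ls′ i≢n))

profile-injective : ∀ {α α′ N} → litBound (proj₁ α) ≤ N → litBound (proj₁ α′) ≤ N →
                    profile α N ≡ profile α′ N → α ≡ α′
profile-injective {α} {α′} {N} bound bound′ same =
  Lint-≡ α α′ (fixedBy-injective (proj₁ α) (proj₁ α′) (proj₂ α) (proj₂ α′) agree)
  where
  agree : ∀ n → fixedBy (proj₁ α) n ≡ fixedBy (proj₁ α′) n
  agree n with n <? N
  ... | yes n<N = profile-agrees same n<N
  ... | no n≮N  = trans (fixedBy-beyond (proj₁ α) (≤-trans bound (≮⇒≥ n≮N)))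
                        (sym (fixedBy-beyond (proj₁ α′) (≤-trans bound′ (≮⇒≥ n≮N))))

literal : Atom × Bool → Form
literal (a , true)  = ⌜ a ⌝
literal (a , false) = f¬ ⌜ a ⌝

⋀Γ : Assignment → Form
⋀Γ Γ = ⋀ (map literal Γ)

⋀-true⇒ : ∀ V {φs φ} → evalF V (⋀ φs) ≡ true → φ ∈ φs → evalF V φ ≡ true
⋀-true⇒ V {φ′ ∷ _} holds (here refl) = proj₁ (to ∧-true⇔ holds)
⋀-true⇒ V {φ′ ∷ _} holds (there φ∈) = ⋀-true⇒ V (proj₂ (to (∧-true⇔ {evalF V φ′}) holds)) φ∈

⋀-true⇐ : ∀ V φs → (∀ {φ} → φ ∈ φs → evalF V φ ≡ true) → evalF V (⋀ φs) ≡ true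
⋀-true⇐ V []       _   = refl
⋀-true⇐ V (φ ∷ φs) all = from ∧-true⇔ (all (here refl) , ⋀-true⇐ V φs (all ∘ there))

⋁-true⇒ : ∀ V φs → evalF V (⋁ φs) ≡ true → Σ Form λ φ → φ ∈ φs × evalF V φ ≡ true
⋁-true⇒ V (φ ∷ φs) holds with evalF V φ in φ-holds
... | true  = φ , here refl , φ-holds
... | false with ψ , ψ∈ , ψ-holds ← ⋁-true⇒ V φs holds = ψ , there ψ∈ , ψ-holds

⋀Γ-true⇒ : ∀ V Γ {a b} → evalF V (⋀Γ Γ) ≡ true → (a , b) ∈ Γ → evalF V ⌜ a ⌝ ≡ b
⋀Γ-true⇒ V Γ {a} {true}  holds e∈ = ⋀-true⇒ V holds (∈-map⁺ literal e∈)
⋀Γ-true⇒ V Γ {a} {false} holds e∈ with evalF V ⌜ a ⌝ | ⋀-true⇒ V holds (∈-map⁺ literal e∈)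
... | false | _ = refl

⋀ᴾ-true⇒ : ∀ v {γs γ} → evalP v (⋀ᴾ γs) ≡ true → γ ∈ γs → evalP v γ ≡ true
⋀ᴾ-true⇒ v {γ′ ∷ _} holds (here refl) = proj₁ (to ∧-true⇔ holds)
⋀ᴾ-true⇒ v {γ′ ∷ _} holds (there γ∈) = ⋀ᴾ-true⇒ v (proj₂ (to (∧-true⇔ {evalP v γ′}) holds)) γ∈

⋁ᴾ-true⇐ : ∀ v {γs γ} → γ ∈ γs → evalP v γ ≡ true → evalP v (⋁ᴾ γs) ≡ true
⋁ᴾ-true⇐ v {γ′ ∷ _}  (here refl) holds rewrite holds = refl
⋁ᴾ-true⇐ v {γ′ ∷ γs} (there γ∈)  holds with evalP v γ′
... | true  = refl
... | false = ⋁ᴾ-true⇐ v γ∈ holds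

varBound-⋀ᴾ : ∀ {M} γs → (∀ {γ} → γ ∈ γs → varBound γ ≤ M) → varBound (⋀ᴾ γs) ≤ M
varBound-⋀ᴾ []       _      = z≤n
varBound-⋀ᴾ (γ ∷ γs) bounds = ⊔-lub (bounds (here refl)) (varBound-⋀ᴾ γs (bounds ∘ there))

varBound-⋁ᴾ : ∀ {M} γs → (∀ {γ} → γ ∈ γs → varBound γ ≤ M) → varBound (⋁ᴾ γs) ≤ M
varBound-⋁ᴾ []       _      = z≤n
varBound-⋁ᴾ (γ ∷ γs) bounds = ⊔-lub (bounds (here refl)) (varBound-⋁ᴾ γs (bounds ∘ there))

atomBound : Atom → ℕ
atomBound (avar i)   = suc i
atomBound (abox α β) = litBound (proj₁ α) ⊔ varBound β

assignmentBound : Assignment → ℕ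
assignmentBound []            = 0
assignmentBound ((a , _) ∷ Γ) = atomBound a ⊔ assignmentBound Γ

atomBound≤assignmentBound : ∀ Γ {a b} → (a , b) ∈ Γ → atomBound a ≤ assignmentBound Γ
atomBound≤assignmentBound ((a , _) ∷ Γ)  (here refl) = m≤m⊔n _ _
atomBound≤assignmentBound ((a′ , _) ∷ Γ) (there e∈)  =
  ≤-trans (atomBound≤assignmentBound Γ e∈) (m≤n⊔m (atomBound a′) _)

selectBox : Bool → Lint → Atom × Bool → List PForm
selectBox b α (avar _ , _)     = []
selectBox b α (abox α′ β , b′) with α′ ≟ᴸ α | b′ ≟ᵇ b
... | yes _ | yes _ = β ∷ []
... | _     | _     = []

boxesAt : Bool → Lint → Assignment → List PForm
boxesAt b α = concatMap (selectBox b α)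

∈-boxesAt⁺ : ∀ {b α β} Γ → (abox α β , b) ∈ Γ → β ∈ boxesAt b α Γ
∈-boxesAt⁺ {b} {α} Γ e∈ = ∈-concatMap-at (selectBox b α) e∈ selected
  where
  selected : ∀ {β} → β ∈ selectBox b α (abox α β , b)
  selected with α ≟ᴸ α | b ≟ᵇ b
  ... | yes _   | yes _   = here refl
  ... | no α≢α  | _       = contradiction refl α≢α
  ... | yes _   | no b≢b  = contradiction refl b≢b

∈-boxesAt⁻ : ∀ {b α β} Γ → β ∈ boxesAt b α Γ → (abox α β , b) ∈ Γ
∈-boxesAt⁻ {b} {α} Γ β∈ with e , e∈ , β∈e ← find (∈-concatMap⁻ (selectBox b α) {xs = Γ} β∈) =
  subst (_∈ Γ) (selected⇒ e β∈e) e∈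
  where
  selected⇒ : ∀ {β} e → β ∈ selectBox b α e → e ≡ (abox α β , b)
  selected⇒ (abox α′ β′ , b′) β∈ with α′ ≟ᴸ α | b′ ≟ᵇ b | β∈
  ... | yes refl | yes refl | here refl = refl

interventionOf : Atom × Bool → List Lint
interventionOf (avar _ , _)    = []
interventionOf (abox α _ , _)  = α ∷ []

interventions : Assignment → List Lint
interventions = concatMap interventionOf

∈-interventions⁺ : ∀ Γ {α β b} → (abox α β , b) ∈ Γ → α ∈ interventions Γ
∈-interventions⁺ Γ e∈ = ∈-concatMap-at interventionOf e∈ (here refl)

∈-interventions⁻ : ∀ Γ {α} → α ∈ interventions Γ →
                   Σ PForm λ β → Σ Bool λ b → (abox α β , b) ∈ Γ
∈-interventions⁻ Γ α∈ = from-found (find (∈-concatMap⁻ interventionOf {xs = Γ} α∈))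
  where
  from-found : ∀ {α} → Σ (Atom × Bool) (λ e → e ∈ Γ × α ∈ interventionOf e) →
               Σ PForm λ β → Σ Bool λ b → (abox α β , b) ∈ Γ
  from-found ((abox _ β , b) , e∈ , here refl) = β , b , e∈

litBound≤assignmentBound : ∀ Γ {α} → α ∈ interventions Γ → litBound (proj₁ α) ≤ assignmentBound Γ
litBound≤assignmentBound Γ α∈ =
  let β , _ , e∈ = ∈-interventions⁻ Γ α∈
  in ≤-trans (m≤m⊔n _ (varBound β)) (atomBound≤assignmentBound Γ e∈)

varBound≤assignmentBound : ∀ Γ {α β b} → (abox α β , b) ∈ Γ → varBound β ≤ assignmentBound Γ
varBound≤assignmentBound Γ {α} e∈ =
  ≤-trans (m≤n⊔m (litBound (proj₁ α)) _) (atomBound≤assignmentBound Γ e∈)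

effective-respected : ∀ ls v n → Respects ls v → effective (fixedBy ls n) (v n) ≡ v n
effective-respected ls v n resp with fixedBy ls n in fixed
... | just c  = sym (resp n c fixed)
... | nothing = refl

module Completeness (d h : Bool) (φ : Form) (valid : Valid (axsys d h) φ) where

  S : AxSys
  S = axsys d h

  open Derivations S

  Refutation : Assignment → Set
  Refutation Γ = Σ Lint λ α → Σ (List PForm) λ βs → (∀ {β} → β ∈ βs → (abox α β , false) ∈ Γ)
               × S ⊢ (⋀ (map (box α) (boxesAt true α Γ)) ⇒ ⋁ (map (box α) βs))

  refutation⇒⊢ : ∀ Γ → Refutation Γ → ∀ ψ → S ⊢ (⋀Γ Γ ⇒ ψ)
  refutation⇒⊢ Γ (α , βs , βs-false , ⊢P⇒Q) ψ =
    pc-mp ⊢P⇒Q (pc-mp (pc-taut inconsistent)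
                      (⊢-instance ((p₀ p⇒ (p₁ p⇒ p₂)) p⇒ (p₁ p⇒ (p₀ p⇒ p₂)))
                                  (⋀Γ Γ ∷ (P ⇒ Q) ∷ ψ ∷ [])))
    where
    P = ⋀ (map (box α) (boxesAt true α Γ))
    Q = ⋁ (map (box α) βs)
    P-holds : ∀ V → evalF V (⋀Γ Γ) ≡ true → evalF V P ≡ true
    P-holds V Γ-holds = ⋀-true⇐ V _ λ φ∈ →
      let β , β∈ , φ≡ = ∈-map⁻ (box α) φ∈
      in subst (λ φ → evalF V φ ≡ true) (sym φ≡) (⋀Γ-true⇒ V Γ Γ-holds (∈-boxesAt⁻ Γ β∈))
    inconsistent : Tautology (⋀Γ Γ ⇒ ((P ⇒ Q) ⇒ ψ))
    inconsistent V with evalF V (⋀Γ Γ) in Γ-holds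
    ... | false = refl
    ... | true with evalF V Q in Q-holds
    ...   | false rewrite P-holds V Γ-holds = refl
    ...   | true with φ , φ∈ , φ-holds ← ⋁-true⇒ V (map (box α) βs) Q-holds
                 with β , β∈ , refl ← ∈-map⁻ (box α) φ∈
                 = contradiction (trans (sym φ-holds) (⋀Γ-true⇒ V Γ Γ-holds (βs-false β∈))) λ ()

  module Leaf (Γ : Assignment) (covers : Covers Γ (atoms φ)) where

    N : ℕ
    N = assignmentBound Γ

    pos neg : Lint → List PForm
    pos α = boxesAt true α Γ
    neg α = boxesAt false α Γ

    target : Lint → PForm
    target α = intP α p∧ ⋀ᴾ (pos α)

    satisfies? : ∀ α w → Dec (evalP (bitAt w) (target α) ≡ true)
    satisfies? α w = evalP (bitAt w) (target α) ≟ᵇ true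

    avoids? : ∀ α w → Dec (All (λ β → evalP (bitAt w) β ≡ false) (neg α))
    avoids? α w = all? (λ β → evalP (bitAt w) β ≟ᵇ false) (neg α)

    satisfying candidates : Lint → List Output
    satisfying α = filter (satisfies? α) (bitLists N)
    candidates α = filter (λ w → satisfies? α w ×-dec avoids? α w) (bitLists N)

    falsified? : ∀ α β → Dec (Any (λ w → evalP (bitAt w) β ≡ false) (satisfying α))
    falsified? α β = any? (λ w → evalP (bitAt w) β ≟ᵇ false) (satisfying α)

    needsOutput : Lint → Bool
    needsOutput α = h ∨ not (null (neg α))

    -- For deterministic machines a single output must falsify every negated box at once.
    outputsFor : Bool → Lint → List Output
    outputsFor false α = satisfying α
    outputsFor true  α = if needsOutput α then take 1 (candidates α) else []

    record Admissible (α : Lint) (ws : List Output) : Set where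
      field
        satisfies     : ∀ {w} → w ∈ ws → evalP (bitAt w) (target α) ≡ true
        falsifies     : ∀ {β} → β ∈ neg α → Σ Output λ w → w ∈ ws × evalP (bitAt w) β ≡ false
        deterministic : d ≡ true → length ws ≤ 1
        total         : h ≡ true → ws ≢ []

    target-bound : ∀ {α} → α ∈ interventions Γ → varBound (target α) ≤ N
    target-bound {α} α∈ = ⊔-lub (≤-trans (varBound-conjP (proj₁ α)) (litBound≤assignmentBound Γ α∈))
                           (varBound-⋀ᴾ (pos α) λ β∈ → varBound≤assignmentBound Γ (∈-boxesAt⁻ Γ β∈))

    neg-bound : ∀ {α β} → β ∈ neg α → varBound β ≤ N
    neg-bound β∈ = varBound≤assignmentBound Γ (∈-boxesAt⁻ Γ β∈)

    box-entailed : ∀ {α γ} → α ∈ interventions Γ → varBound γ ≤ N →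
                   (∀ {w} → w ∈ bitLists N → evalP (bitAt w) (target α) ≡ true →
                            evalP (bitAt w) γ ≡ true) →
                   S ⊢ (⋀ (map (box α) (pos α)) ⇒ box α γ)
    box-entailed {α} {γ} α∈ γ-bound entails =
      ⇒-trans (box-⋀ α (pos α))
              (rule-RW (⊢ι (bitLists-complete N (λ v → evalP v (target α p⇒ γ) ≡ true) local on-bitLists)))
      where
      local : ∀ {v w} → (∀ n → n < N → v n ≡ w n) →
              evalP w (target α p⇒ γ) ≡ true → evalP v (target α p⇒ γ) ≡ true
      local {v} {w} agree holds =
        trans (evalP-cong (target α p⇒ γ) v w λ n n< →
                 agree n (<-≤-trans n< (⊔-lub (target-bound α∈) γ-bound)))
              holds
      on-bitLists : ∀ {w} → w ∈ bitLists N → evalP (bitAt w) (target α p⇒ γ) ≡ true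
      on-bitLists {w} w∈ with evalP (bitAt w) (target α) in sat
      ... | false = refl
      ... | true rewrite entails w∈ sat = refl

    refute-unfalsifiable : ∀ {α β} → α ∈ interventions Γ → β ∈ neg α →
                           (∀ {w} → w ∈ satisfying α → evalP (bitAt w) β ≡ true) → Refutation Γ
    refute-unfalsifiable {α} {β} α∈ β∈ unfalsified =
      α , β ∷ [] , (λ { (here refl) → ∈-boxesAt⁻ Γ β∈ }) ,
      pc-mp (box-entailed α∈ (neg-bound β∈) λ w∈ sat → unfalsified (∈-filter⁺ (satisfies? α) w∈ sat))
            (⊢-instance ((p₀ p⇒ p₁) p⇒ (p₀ p⇒ (p₁ p∨ ⊥ᴾ)))
                        (⋀ (map (box α) (pos α)) ∷ box α β ∷ []))

    refute-unsatisfiable : ∀ {α} → α ∈ interventions Γ → h ≡ true → satisfying α ≡ [] → Refutation Γ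
    refute-unsatisfiable {α} α∈ h≡true none =
      α , [] , (λ ()) ,
      ⇒-trans (box-entailed α∈ z≤n λ w∈ sat →
                 contradiction (subst (_ ∈_) none (∈-filter⁺ (satisfies? α) w∈ sat)) λ ())
              (box-⊥ h≡true α)

    box-⊥⇒⋁ : ∀ α βs → h ∨ not (null βs) ≡ true → S ⊢ (box α ⊥ᴾ ⇒ ⋁ (map (box α) βs))
    box-⊥⇒⋁ α []       h≡true = box-⊥ (trans (sym (∨-identityʳ h)) h≡true) α
    box-⊥⇒⋁ α (β ∷ βs) _      =
      ⇒-trans (box-⊥-elim α β) (⊢-instance (p₀ p⇒ (p₀ p∨ p₁)) (box α β ∷ ⋁ (map (box α) βs) ∷ []))

    refute-no-candidate : ∀ {α} → α ∈ interventions Γ → d ≡ true →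
                          needsOutput α ≡ true → candidates α ≡ [] → Refutation Γ
    refute-no-candidate {α} α∈ d≡true needed none =
      α , neg α , ∈-boxesAt⁻ Γ ,
      mp₂ (⇒-trans (box-entailed α∈ (varBound-⋁ᴾ (neg α) neg-bound) some-negative-holds)
                   (box-⋁ d≡true α (neg α)))
          (box-⊥⇒⋁ α (neg α) needed)
          (⊢-instance ((p₀ p⇒ (p₁ p∨ p₂)) p⇒ ((p₂ p⇒ p₁) p⇒ (p₀ p⇒ p₁)))
                      (⋀ (map (box α) (pos α)) ∷ ⋁ (map (box α) (neg α)) ∷ box α ⊥ᴾ ∷ []))
      where
      some-negative-holds : ∀ {w} → w ∈ bitLists N → evalP (bitAt w) (target α) ≡ true →
                            evalP (bitAt w) (⋁ᴾ (neg α)) ≡ true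
      some-negative-holds {w} w∈ sat with avoids? α w
      ... | yes avoids =
        contradiction (subst (_ ∈_) none (∈-filter⁺ (λ w → satisfies? α w ×-dec avoids? α w) w∈ (sat , avoids)))
                      λ ()
      ... | no ¬avoids
        with β , β∈ , β≢false ← find (¬All⇒Any¬ (λ β → evalP (bitAt w) β ≟ᵇ false) (neg α) ¬avoids)
        = ⋁ᴾ-true⇐ (bitAt w) β∈ (¬-not β≢false)

    admissible-single : ∀ {α w} → w ∈ candidates α → Admissible α (w ∷ [])
    admissible-single {α} w∈ = record
      { satisfies     = λ { (here refl) → proj₁ fits }
      ; falsifies     = λ β∈ → _ , here refl , All.lookup (proj₂ fits) β∈
      ; deterministic = λ _ → s≤s z≤n
      ; total         = λ _ () }
      where fits = proj₂ (∈-filter⁻ (λ w → satisfies? α w ×-dec avoids? α w) {xs = bitLists N} w∈)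

    admissible-none : ∀ {α} → needsOutput α ≡ false → Admissible α []
    admissible-none {α} unneeded = record
      { satisfies     = λ ()
      ; falsifies     = λ β∈ → contradiction (subst (_ ∈_) (proj₂ h∧no-neg) β∈) λ ()
      ; deterministic = λ _ → z≤n
      ; total         = λ h≡true → contradiction (trans (sym h≡true) (proj₁ h∧no-neg)) λ () }
      where
      ∨-not-null : ∀ b (xs : List PForm) → b ∨ not (null xs) ≡ false → b ≡ false × xs ≡ []
      ∨-not-null false []      _ = refl , refl
      ∨-not-null false (_ ∷ _) ()
      ∨-not-null true  _       ()
      h∧no-neg = ∨-not-null h (neg α) unneeded

    admissible-satisfying : ∀ {α} → d ≡ false →
                            All (λ β → Any (λ w → evalP (bitAt w) β ≡ false) (satisfying α)) (neg α) →
                            (h ≡ true → satisfying α ≢ []) → Admissible α (satisfying α)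
    admissible-satisfying {α} d≡false falsified nonempty = record
      { satisfies     = λ w∈ → proj₂ (∈-filter⁻ (satisfies? α) {xs = bitLists N} w∈)
      ; falsifies     = λ β∈ → find (All.lookup falsified β∈)
      ; deterministic = λ d≡true → contradiction (trans (sym d≡false) d≡true) λ ()
      ; total         = nonempty }

    check-deterministic : ∀ {α} → α ∈ interventions Γ → d ≡ true →
                          Refutation Γ ⊎ Admissible α (outputsFor true α)
    check-deterministic {α} α∈ d≡true with needsOutput α in needed
    ... | false = inj₂ (admissible-none needed)
    ... | true with candidates α in cands
    ...   | []    = inj₁ (refute-no-candidate α∈ d≡true needed cands)
    ...   | w ∷ _ = inj₂ (admissible-single (subst (w ∈_) (sym cands) (here refl)))

    check-total : ∀ {α} → α ∈ interventions Γ → Refutation Γ ⊎ (h ≡ true → satisfying α ≢ [])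
    check-total {α} α∈ with h ≟ᵇ true | satisfying α in sats
    ... | yes h≡true | []    = inj₁ (refute-unsatisfiable α∈ h≡true sats)
    ... | yes _      | _ ∷ _ = inj₂ λ _ ()
    ... | no h≢true  | _     = inj₂ λ h≡true → contradiction h≡true h≢true

    check-nondeterministic : ∀ {α} → α ∈ interventions Γ → d ≡ false →
                             Refutation Γ ⊎ Admissible α (outputsFor false α)
    check-nondeterministic {α} α∈ d≡false with all? (falsified? α) (neg α)
    ... | no ¬all with β , β∈ , ¬falsified ← find (¬All⇒Any¬ (falsified? α) (neg α) ¬all)
      = inj₁ (refute-unfalsifiable α∈ β∈ λ w∈ → ¬-not (All.lookup (¬Any⇒All¬ _ ¬falsified) w∈))
    ... | yes falsified with check-total α∈
    ...   | inj₁ refutation = inj₁ refutation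
    ...   | inj₂ nonempty   = inj₂ (admissible-satisfying d≡false falsified nonempty)

    check : ∀ {α} → α ∈ interventions Γ → Refutation Γ ⊎ Admissible α (outputsFor d α)
    check α∈ = check′ d refl
      where
      check′ : ∀ d′ → d ≡ d′ → Refutation Γ ⊎ Admissible _ (outputsFor d′ _)
      check′ true  d≡true  = check-deterministic α∈ d≡true
      check′ false d≡false = check-nondeterministic α∈ d≡false

    check-all : ∀ αs → (∀ {α} → α ∈ αs → α ∈ interventions Γ) →
                Refutation Γ ⊎ (∀ {α} → α ∈ αs → Admissible α (outputsFor d α))
    check-all []       _  = inj₂ λ ()
    check-all (α ∷ αs) ⊆Γ with check (⊆Γ (here refl)) | check-all αs (⊆Γ ∘ there)
    ... | inj₁ refutation | _               = inj₁ refutation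
    ... | inj₂ _          | inj₁ refutation = inj₁ refutation
    ... | inj₂ ok         | inj₂ oks        = inj₂ λ { (here refl) → ok ; (there α∈) → oks α∈ }

    row : Lint → Profile × List Output
    row α = profile α N , outputsFor d α

    table : Table
    table = map row (interventions Γ)

    open ProbeMachine N table using (machine; machine-deterministic; δ-length≤1; module Run)

    countermodel : Model
    countermodel = model machine (truncate (λ i → valueIn Γ (avar i)) N)

    lookupRow-table : ∀ {α} → α ∈ interventions Γ → lookupRow (profile α N) table ≡ just (outputsFor d α)
    lookupRow-table {α} α∈ = lookupRow-rows (interventions Γ) (λ α′∈ → α′∈) α∈
      where
      lookupRow-rows : ∀ αs → (∀ {α′} → α′ ∈ αs → α′ ∈ interventions Γ) → α ∈ αs →
                       lookupRow (profile α N) (map row αs) ≡ just (outputsFor d α)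
      lookupRow-rows (α′ ∷ αs) ⊆Γ α∈αs with profile α N ≟ᵖ profile α′ N
      ... | yes same = cong (just ∘ outputsFor d)
                            (sym (profile-injective (litBound≤assignmentBound Γ α∈)
                                                    (litBound≤assignmentBound Γ (⊆Γ (here refl))) same))
      ... | no differ with α∈αs
      ...   | here refl  = contradiction refl differ
      ...   | there α∈αs′ = lookupRow-rows αs (⊆Γ ∘ there) α∈αs′

    countermodel-∈ : (∀ {α} → α ∈ interventions Γ → Admissible α (outputsFor d α)) → InClass S countermodel
    countermodel-∈ admissible =
      (λ d≡true → machine-deterministic (δ-length≤1 (every-row λ α∈ →
                    Admissible.deterministic (admissible α∈) d≡true))) ,
      (λ h≡true α x → Run.FromInput.halts α (proj₁ x) (every-row λ α∈ →
                        Admissible.total (admissible α∈) h≡true))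
      where
      every-row : ∀ {P : List Output → Set} → (∀ {α} → α ∈ interventions Γ → P (outputsFor d α)) →
                  ∀ {r} → r ∈ table → P (proj₂ r)
      every-row P-rows r∈ with α , α∈ , refl ← ∈-map⁻ row r∈ = P-rows α∈

    module _ (admissible : ∀ {α} → α ∈ interventions Γ → Admissible α (outputsFor d α)) where

      output-agrees : ∀ {α β b w t} → α ∈ interventions Γ → (abox α β , b) ∈ Γ → w ∈ outputsFor d α →
                      (∀ n → n < N → t n ≡ effective (fixedBy (proj₁ α) n) (bitAt w n)) →
                      evalP t β ≡ evalP (bitAt w) β
      output-agrees {α} {β} {w = w} {t} α∈ e∈ w∈ agrees =
        evalP-cong β t (bitAt w) λ n n< →
          trans (agrees n (<-≤-trans n< (varBound≤assignmentBound Γ e∈)))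
                (effective-respected (proj₁ α) (bitAt w) n respects)
        where
        respects = to (intP-true⇔ α (bitAt w)) (proj₁ (to ∧-true⇔ (Admissible.satisfies (admissible α∈) w∈)))

      box-truth : ∀ {α β b} → (abox α β , b) ∈ Γ → (countermodel ⊨ box α β) ⇔ (b ≡ true)
      box-truth {α} {β} {true} e∈ = mk⇔ (λ _ → refl) λ _ t run →
        let α∈ = ∈-interventions⁺ Γ e∈
            w , w∈ , agrees = Run.FromInput.HRun⇒output α _ (lookupRow-table α∈) run
            pos-hold = proj₂ (to ∧-true⇔ (Admissible.satisfies (admissible α∈) w∈))
        in trans (output-agrees α∈ e∈ w∈ agrees) (⋀ᴾ-true⇒ (bitAt w) pos-hold (∈-boxesAt⁺ Γ e∈))
      box-truth {α} {β} {false} e∈ = mk⇔ refuted λ ()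
        where
        refuted : countermodel ⊨ box α β → false ≡ true
        refuted ⊨box =
          let α∈ = ∈-interventions⁺ Γ e∈
              w , w∈ , β-false = Admissible.falsifies (admissible α∈) (∈-boxesAt⁺ Γ e∈)
              t , run , agrees = Run.FromInput.output⇒HRun α _ (lookupRow-table α∈) w∈
          in trans (sym β-false) (trans (sym (output-agrees α∈ e∈ w∈ agrees)) (⊨box t run))

      var-truth : ∀ {i b} → (avar i , b) ∈ Γ → (countermodel ⊨ var i) ⇔ (valueIn Γ (avar i) ≡ true)
      var-truth e∈ = mk⇔ (trans (sym truncated)) (trans truncated)
        where truncated = truncate-below (λ i → valueIn Γ (avar i)) (atomBound≤assignmentBound Γ e∈)

      countermodel-truth : (countermodel ⊨ φ) ⇔ (evalF (valuation Γ) φ ≡ true)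
      countermodel-truth = truth-lemma countermodel (valuation Γ) φ atom-truth
        where
        atom-truth : ∀ {a} → a ∈ atoms φ → (countermodel ⊨ ⌜ a ⌝) ⇔ (evalF (valuation Γ) ⌜ a ⌝ ≡ true)
        atom-truth {avar i}   a∈ = var-truth (valueIn-∈ Γ (proj₂ (covers a∈)))
        atom-truth {abox α β} a∈ = box-truth (valueIn-∈ Γ (proj₂ (covers a∈)))

    ⋀Γ-agrees : ∀ V → evalF V (⋀Γ Γ) ≡ true →
                ∀ {a} → a ∈ atoms φ → evalF V ⌜ a ⌝ ≡ evalF (valuation Γ) ⌜ a ⌝
    ⋀Γ-agrees V Γ-holds {a} a∈ =
      trans (⋀Γ-true⇒ V Γ Γ-holds (valueIn-∈ Γ (proj₂ (covers a∈)))) (sym (evalF-valuation Γ a))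

    ⋀Γ⇒φ-tautology : evalF (valuation Γ) φ ≡ true → Tautology (⋀Γ Γ ⇒ φ)
    ⋀Γ⇒φ-tautology φ-holds V with evalF V (⋀Γ Γ) in Γ-holds
    ... | false = refl
    ... | true rewrite trans (evalF-cong V (valuation Γ) φ (⋀Γ-agrees V Γ-holds)) φ-holds = refl

    leaf : S ⊢ (⋀Γ Γ ⇒ φ)
    leaf with evalF (valuation Γ) φ in φ-value
    ... | true = pc-taut (⋀Γ⇒φ-tautology φ-value)
    ... | false with check-all (interventions Γ) (λ α∈ → α∈)
    ...   | inj₁ refutation = refutation⇒⊢ Γ refutation φ
    ...   | inj₂ admissible =
      let φ-holds = to (countermodel-truth admissible) (valid countermodel (countermodel-∈ admissible))
      in contradiction (trans (sym φ-value) φ-holds) λ ()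

  split : ∀ as Γ → (∀ {a} → a ∈ atoms φ → a ∈ as ⊎ Σ Bool λ b → (a , b) ∈ Γ) →
          S ⊢ (⋀Γ Γ ⇒ φ)
  split []       Γ covered = Leaf.leaf Γ λ a∈ → [ (λ ()) , (λ c → c) ]′ (covered a∈)
  split (a ∷ as) Γ covered =
    mp₂ (split as ((a , true) ∷ Γ) (extend true)) (split as ((a , false) ∷ Γ) (extend false))
        (⊢-instance (((p₁ p∧ p₀) p⇒ p₂) p⇒ (((p¬ p₁ p∧ p₀) p⇒ p₂) p⇒ (p₀ p⇒ p₂)))
                    (⋀Γ Γ ∷ ⌜ a ⌝ ∷ φ ∷ []))
    where
    extend : ∀ b {a′} → a′ ∈ atoms φ → a′ ∈ as ⊎ Σ Bool λ b′ → (a′ , b′) ∈ (a , b) ∷ Γ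
    extend b a′∈ with covered a′∈
    ... | inj₁ (here refl)   = inj₂ (b , here refl)
    ... | inj₁ (there a′∈as) = inj₁ a′∈as
    ... | inj₂ (b′ , e∈)     = inj₂ (b′ , there e∈)

  completeness : S ⊢ φ
  completeness = pc-mp (split (atoms φ) [] inj₁) (⊢-instance ((p⊤ p⇒ p₀) p⇒ p₀) (φ ∷ []))

theorem1 : (S : AxSys) (φ : Form) → (S ⊢ φ) ⇔ Valid S φ
theorem1 (axsys d h) φ = mk⇔ soundness (Completeness.completeness d h φ)
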